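{- For every finite group $\mathfrak{G}$ there exist infinitely many pairwise non-isomorphic finite nut graphs $G$ such that $\mathrm{Aut}(G) \cong \mathfrak{G}$.
   Context: All graphs are finite, simple and connected. For a graph $G$, $\mathbf{A}(G)$ denotes its adjacency matrix and the nullity $\eta(G)$ is the dimension of the kernel of $\mathbf{A}(G)$. A nut graph is a simple graph of order at least 2 with $\eta(G)=1$ such that a (equivalently every) non-zero vector $\mathbf{x}=[x_1,\dots,x_n]^\intercal \in \ker \mathbf{A}(G)$ is full, i.e. $x_i \neq 0$ for all $i=1,\dots,n$. $\mathrm{Aut}(G)$ is the full automorphism group of $G$, i.e. the group of all permutations of $V(G)$ mapping edges to edges and non-edges to non-edges. -}

module Defs where

open import Level using (Level; _⊔_)
open import Data.Nat using (ℕ; zero; suc; _≤_)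
open import Data.Fin using (Fin; zero; suc)
open import Data.Bool using (Bool; true; false; if_then_else_)
open import Data.Rational using (ℚ; 0ℚ; 1ℚ; _+_; _*_)
open import Data.Product using (Σ; ∃; _×_; _,_)
open import Relation.Binary.PropositionalEquality using (_≡_; _≢_)
open import Relation.Nullary using (¬_)
open import Algebra.Bundles using (Group)

record Graph : Set where
  field
    order  : ℕ
    adj    : Fin order → Fin order → Bool
    adj-sym    : ∀ i j → adj i j ≡ adj j i
    adj-irrefl : ∀ i → adj i i ≡ false
open Graph public

data Reach (G : Graph) : Fin (order G) → Fin (order G) → Set where
  here : ∀ {i} → Reach G i i
  step : ∀ {i j k} → adj G i j ≡ true → Reach G j k → Reach G i k

Connected : Graph → Set
Connected G = ∀ i j → Reach G i j

sumFin : ∀ {n} → (Fin n → ℚ) → ℚ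
sumFin {zero}  f = 0ℚ
sumFin {suc n} f = f zero + sumFin (λ i → f (suc i))

AdjMatrix : (G : Graph) → Fin (order G) → Fin (order G) → ℚ
AdjMatrix G i j = if adj G i j then 1ℚ else 0ℚ

InKernel : (G : Graph) → (Fin (order G) → ℚ) → Set
InKernel G x = ∀ i → sumFin (λ j → AdjMatrix G i j * x j) ≡ 0ℚ

NonZeroVec : ∀ {n} → (Fin n → ℚ) → Set
NonZeroVec x = ∃ λ i → x i ≢ 0ℚ

Full : ∀ {n} → (Fin n → ℚ) → Set
Full x = ∀ i → x i ≢ 0ℚ

NullityOne : Graph → Set
NullityOne G =
  Σ (Fin (order G) → ℚ) λ x → InKernel G x × NonZeroVec x ×
    (∀ y → InKernel G y → ∃ λ c → ∀ i → y i ≡ c * x i)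

-- nut graph (graphs are connected by the standing convention)
IsNut : Graph → Set
IsNut G = 2 ≤ order G × Connected G × NullityOne G ×
          (∀ x → InKernel G x → NonZeroVec x → Full x)

record GraphIso (G H : Graph) : Set where
  field
    to   : Fin (order G) → Fin (order H)
    from : Fin (order H) → Fin (order G)
    from-to : ∀ i → from (to i) ≡ i
    to-from : ∀ j → to (from j) ≡ j
    preserves : ∀ i j → adj H (to i) (to j) ≡ adj G i j

Automorphism : Graph → Set
Automorphism G = GraphIso G G

_≐_ : ∀ {G} → Automorphism G → Automorphism G → Set
σ ≐ τ = ∀ i → GraphIso.to σ i ≡ GraphIso.to τ i

record AutIso {c ℓ} (𝔊 : Group c ℓ) (G : Graph) : Set (c ⊔ ℓ) where
  open Group 𝔊
  field
    φ      : Carrier → Automorphism G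
    φ-cong : ∀ {x y} → x ≈ y → φ x ≐ φ y
    φ-hom  : ∀ x y i → GraphIso.to (φ (x ∙ y)) i
                       ≡ GraphIso.to (φ x) (GraphIso.to (φ y) i)
    φ-injective  : ∀ {x y} → φ x ≐ φ y → x ≈ y
    φ-surjective : ∀ (σ : Automorphism G) → ∃ λ x → φ x ≐ σ

FiniteGroup : ∀ {c ℓ} → Group c ℓ → Set (c ⊔ ℓ)
FiniteGroup 𝔊 = ∃ λ (n : ℕ) → Σ (Carrier → Fin n) λ to → Σ (Fin n → Carrier) λ from →
    (∀ {x y} → x ≈ y → to x ≡ to y) × (∀ x → from (to x) ≈ x) × (∀ i → to (from i) ≡ i)
  where open Group 𝔊

{-# OPTIONS --safe #-}
-- Take one copy of a fixed gadget for every element x of the group and, for each of the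
-- K = m + n + 2 colours k, join the hub P of copy x to the vertex B k of copy x · c_k, where the
-- colour labels c_k run through the group (padded with m + 2 copies of ε).  Left multiplications
-- are then automorphisms.  Solving the kernel equations through one gadget expresses every entry
-- of a kernel vector through its values g at the hubs, with weights ±1 except 2k + 1 and −(2k + 2)
-- on the k-th rung of a ladder and ∓(2K + 1) on Q and R′; the equation at P then reads
-- n · g x = Σ g, so g is constant.  Hence the kernel is spanned by one full vector and the
-- (clearly connected) graph is a nut graph.  An automorphism rescales that vector and preserves
-- degrees; the hubs have a degree of their own, which fixes the scale to 1.  Degrees and weights
-- then identify the layer of every vertex (a few ties are broken by neighbours), in particular
-- the colours, so the automorphism acts on copies by a map π with π (x c) = π x · c, that is, by
-- left multiplication with π ε.  The orders n (7 + 6K) differ for different m.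

module Submission where

open import Defs
open import Level using (0ℓ)
open import Function using (_∘_; id; _↔_; Inverse; mk↔ₛ′)
open import Function.Bundles using (mk⇔)
open import Function.Properties.Inverse using (↔-refl; ↔-sym; ↔-trans)
open import Data.Empty using (⊥-elim)
open import Data.Nat as ℕ using (ℕ; zero; suc)
import Data.Nat.Properties as ℕ
open import Data.Fin using (Fin; zero; suc; toℕ; inject₁; fromℕ; fromℕ<; splitAt; _↑ˡ_; _↑ʳ_)
open import Data.Fin.Patterns using (0F; 1F; 2F; 3F; 4F; 5F; 6F)
import Data.Fin.Properties as Fin
import Data.Fin.Permutation as Perm
open import Data.Fin.Induction using (<-weakInduction)
open import Data.Fin.Relation.Unary.Top using (view; ‵fromℕ; ‵inj₁; view-fromℕ; view-inject₁)
open import Data.Bool using (Bool; true; if_then_else_)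
open import Data.Rational using (ℚ; 0ℚ; 1ℚ; _+_; _*_; -_; _≤_; _<_; 1/_; NonZero; ≢-nonZero)
import Data.Rational.Properties as ℚ
open import Data.List using (List; []; _∷_; _++_; map; tabulate; foldr; length)
import Data.List.Properties as List
open import Data.List.Relation.Unary.Any using (here; there)
open import Data.List.Membership.Propositional using (_∈_; _∉_)
open import Data.List.Membership.Propositional.Properties using (∈-map⁺; ∈-map⁻; ∈-++⁺ˡ; ∈-++⁺ʳ; ∈-++⁻; ∈-tabulate⁺; ∈-tabulate⁻)
import Data.List.Membership.DecPropositional as DecMembership
open import Data.List.Relation.Unary.All using (All; []; _∷_)
import Data.List.Relation.Unary.All.Properties as All
open import Data.List.Relation.Unary.AllPairs using ([]; _∷_)
open import Data.List.Relation.Unary.Unique.Propositional using (Unique)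
import Data.List.Relation.Unary.Unique.Propositional.Properties as Unique
open import Data.Product using (Σ; ∃; _×_; _,_; proj₁; proj₂)
open import Data.Product.Function.NonDependent.Propositional using (_×-↔_)
open import Data.Sum using (_⊎_; inj₁; inj₂; [_,_])
open import Data.Sum.Function.Propositional using (_⊎-↔_)
open import Relation.Binary.PropositionalEquality hiding ([_])
open import Relation.Nullary using (¬_; Dec; does; yes; no)
open import Relation.Nullary.Decidable using (dec⇒maybe; does-⇔; dec-true; dec-false)
open import Algebra.Bundles using (Group)
open import Algebra.Structures using (IsGroup)
import Algebra.Properties.Group as GroupProperties
import Algebra.Properties.CommutativeMonoid.Sum as CommutativeMonoidSum
open import Tactic.RingSolver using (solve-∀)
open import Tactic.RingSolver.Core.AlmostCommutativeRing using (AlmostCommutativeRing; fromCommutativeRing)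

open ≡-Reasoning

ℚ-ring : AlmostCommutativeRing 0ℓ 0ℓ
ℚ-ring = fromCommutativeRing ℚ.+-*-commutativeRing (λ x → dec⇒maybe (0ℚ ℚ.≟ x))

private
  module ℚ+ = GroupProperties ℚ.+-0-group
  module ℚSum = CommutativeMonoidSum ℚ.+-0-commutativeMonoid

0<1 : 0ℚ < 1ℚ
0<1 = ℚ.positive⁻¹ 1ℚ

toℚ : ℕ → ℚ
toℚ zero    = 0ℚ
toℚ (suc a) = 1ℚ + toℚ a

toℚ-+ : ∀ a b → toℚ (a ℕ.+ b) ≡ toℚ a + toℚ b
toℚ-+ zero    b = sym (ℚ.+-identityˡ (toℚ b))
toℚ-+ (suc a) b = trans (cong (1ℚ +_) (toℚ-+ a b)) (sym (ℚ.+-assoc 1ℚ (toℚ a) (toℚ b)))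

0≤toℚ : ∀ a → 0ℚ ≤ toℚ a
0≤toℚ zero    = ℚ.≤-refl
0≤toℚ (suc a) = ℚ.+-mono-≤ (ℚ.<⇒≤ 0<1) (0≤toℚ a)

0<toℚ-suc : ∀ a → 0ℚ < toℚ (suc a)
0<toℚ-suc a = ℚ.+-mono-<-≤ 0<1 (0≤toℚ a)

toℚ-suc≢0 : ∀ a → toℚ (suc a) ≢ 0ℚ
toℚ-suc≢0 a eq = ℚ.<-irrefl (sym eq) (0<toℚ-suc a)

toℚ-≢0 : ∀ {a} → Fin a → toℚ a ≢ 0ℚ
toℚ-≢0 {suc a} _ = toℚ-suc≢0 a

toℚ-injective : ∀ {a b} → toℚ a ≡ toℚ b → a ≡ b
toℚ-injective {zero}  {zero}  _  = refl
toℚ-injective {zero}  {suc b} eq = ⊥-elim (toℚ-suc≢0 b (sym eq))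
toℚ-injective {suc a} {zero}  eq = ⊥-elim (toℚ-suc≢0 a eq)
toℚ-injective {suc a} {suc b} eq = cong suc (toℚ-injective (ℚ+.∙-cancelˡ 1ℚ (toℚ a) (toℚ b) eq))

+-self-injective : ∀ {a b} → a ℕ.+ a ≡ b ℕ.+ b → a ≡ b
+-self-injective {a} {b} eq = trans (ℕ.n≡⌊n+n/2⌋ a) (trans (cong ℕ.⌊_/2⌋ eq) (sym (ℕ.n≡⌊n+n/2⌋ b)))

odd : ℕ → ℚ
odd a = toℚ (suc (a ℕ.+ a))

odd-suc : ∀ a → odd (suc a) ≡ 1ℚ + (1ℚ + (1ℚ + toℚ (a ℕ.+ a)))
odd-suc a = cong (λ b → toℚ (suc (suc b))) (ℕ.+-suc a a)

odd-injective : ∀ {a b} → odd a ≡ odd b → a ≡ b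
odd-injective = +-self-injective ∘ ℕ.suc-injective ∘ toℚ-injective

*-cancelˡ-≢0 : ∀ {a} b c → a ≢ 0ℚ → a * b ≡ a * c → b ≡ c
*-cancelˡ-≢0 {a} b c a≢0 eq = begin
  b              ≡⟨ sym (ℚ.*-identityˡ b) ⟩
  1ℚ * b         ≡⟨ cong (_* b) (sym (ℚ.*-inverseˡ a)) ⟩
  (1/ a * a) * b ≡⟨ ℚ.*-assoc (1/ a) a b ⟩
  1/ a * (a * b) ≡⟨ cong (1/ a *_) eq ⟩
  1/ a * (a * c) ≡⟨ sym (ℚ.*-assoc (1/ a) a c) ⟩
  (1/ a * a) * c ≡⟨ cong (_* c) (ℚ.*-inverseˡ a) ⟩
  1ℚ * c         ≡⟨ ℚ.*-identityˡ c ⟩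
  c              ∎
  where
  instance
    a-nonZero : NonZero a
    a-nonZero = ≢-nonZero a≢0

*-≢0 : ∀ {a b} → a ≢ 0ℚ → b ≢ 0ℚ → a * b ≢ 0ℚ
*-≢0 {a} {b} a≢0 b≢0 ab≡0 = b≢0 (*-cancelˡ-≢0 b 0ℚ a≢0 (trans ab≡0 (sym (ℚ.*-zeroʳ a))))

neg-≢0 : ∀ {a} → a ≢ 0ℚ → - a ≢ 0ℚ
neg-≢0 a≢0 -a≡0 = a≢0 (ℚ.neg-injective -a≡0)

pos≢neg : ∀ {p q} → 0ℚ < p → q < 0ℚ → p ≢ q
pos≢neg 0<p q<0 refl = ℚ.<-irrefl refl (ℚ.<-trans q<0 0<p)

-- To derive t ≡ s from hypotheses aᵢ ≡ bᵢ, weigh the differences aᵢ - bᵢ with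
-- coefficients cᵢ into a sum z ≡ 0 and let the ring solver check t ≡ s + z.
diff≡0 : ∀ {a b} → a ≡ b → ∀ c → (a + - b) * c ≡ 0ℚ
diff≡0 {a} refl c = trans (cong (_* c) (ℚ.+-inverseʳ a)) (ℚ.*-zeroˡ c)

infixr 5 _+₀_
_+₀_ : ∀ {a b} → a ≡ 0ℚ → b ≡ 0ℚ → a + b ≡ 0ℚ
refl +₀ refl = refl

linear-combination : ∀ {t s z} → z ≡ 0ℚ → t ≡ s + z → t ≡ s
linear-combination {s = s} refl t≡s+0 = trans t≡s+0 (ℚ.+-identityʳ s)

sumFin≡sum : ∀ {K} (f : Fin K → ℚ) → sumFin f ≡ ℚSum.sum f
sumFin≡sum {zero}  f = refl
sumFin≡sum {suc K} f = cong (f zero +_) (sumFin≡sum (f ∘ suc))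

sumFin-cong : ∀ {K} {f g : Fin K → ℚ} → (∀ i → f i ≡ g i) → sumFin f ≡ sumFin g
sumFin-cong {zero}  f≗g = refl
sumFin-cong {suc K} f≗g = cong₂ _+_ (f≗g zero) (sumFin-cong (f≗g ∘ suc))

sumFin-+ : ∀ {K} (f g : Fin K → ℚ) → sumFin (λ i → f i + g i) ≡ sumFin f + sumFin g
sumFin-+ f g = begin
  sumFin (λ i → f i + g i) ≡⟨ sumFin≡sum (λ i → f i + g i) ⟩
  ℚSum.sum (λ i → f i + g i)  ≡⟨ ℚSum.∑-distrib-+ f g ⟩
  ℚSum.sum f + ℚSum.sum g        ≡⟨ sym (cong₂ _+_ (sumFin≡sum f) (sumFin≡sum g)) ⟩
  sumFin f + sumFin g      ∎

sumFin-const : ∀ K (c : ℚ) → sumFin {K} (λ _ → c) ≡ toℚ K * c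
sumFin-const zero    c = sym (ℚ.*-zeroˡ c)
sumFin-const (suc K) c = begin
  c + sumFin {K} (λ _ → c) ≡⟨ cong₂ _+_ (sym (ℚ.*-identityˡ c)) (sumFin-const K c) ⟩
  1ℚ * c + toℚ K * c       ≡⟨ sym (ℚ.*-distribʳ-+ c 1ℚ (toℚ K)) ⟩
  toℚ (suc K) * c          ∎

sumFin-↑ : ∀ a b (f : Fin (a ℕ.+ b) → ℚ) → sumFin f ≡ sumFin (λ i → f (i ↑ˡ b)) + sumFin (λ j → f (a ↑ʳ j))
sumFin-↑ zero    b f = sym (ℚ.+-identityˡ _)
sumFin-↑ (suc a) b f = trans (cong (f zero +_) (sumFin-↑ a b (f ∘ suc))) (sym (ℚ.+-assoc (f zero) _ _))

sumFin-permute : ∀ {K} (f : Fin K → ℚ) (π π⁻¹ : Fin K → Fin K) →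
  (∀ i → π (π⁻¹ i) ≡ i) → (∀ i → π⁻¹ (π i) ≡ i) → sumFin (f ∘ π) ≡ sumFin f
sumFin-permute f π π⁻¹ ππ⁻¹ π⁻¹π = begin
  sumFin (f ∘ π) ≡⟨ sumFin≡sum (f ∘ π) ⟩
  ℚSum.sum (f ∘ π)  ≡⟨ sym (ℚSum.sum-permute f (Perm.permutation π π⁻¹ ππ⁻¹ π⁻¹π)) ⟩
  ℚSum.sum f        ≡⟨ sym (sumFin≡sum f) ⟩
  sumFin f       ∎

sumList : List ℚ → ℚ
sumList = foldr _+_ 0ℚ

sumList-++ : ∀ xs ys → sumList (xs ++ ys) ≡ sumList xs + sumList ys
sumList-++ []       ys = sym (ℚ.+-identityˡ _)
sumList-++ (x ∷ xs) ys = trans (cong (x +_) (sumList-++ xs ys)) (sym (ℚ.+-assoc x (sumList xs) (sumList ys)))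

sumList-tabulate : ∀ {K} (f : Fin K → ℚ) → sumList (tabulate f) ≡ sumFin f
sumList-tabulate {zero}  f = refl
sumList-tabulate {suc K} f = cong (f zero +_) (sumList-tabulate (f ∘ suc))

sumList-map-++ : ∀ {A : Set} (Y : A → ℚ) xs ys → sumList (map Y (xs ++ ys)) ≡ sumList (map Y xs) + sumList (map Y ys)
sumList-map-++ Y xs ys = trans (cong sumList (List.map-++ Y xs ys)) (sumList-++ (map Y xs) (map Y ys))

sumList-map-tabulate : ∀ {A : Set} {K} (Y : A → ℚ) (f : Fin K → A) → sumList (map Y (tabulate f)) ≡ sumFin (Y ∘ f)
sumList-map-tabulate Y f = trans (cong sumList (List.map-tabulate f Y)) (sumList-tabulate (Y ∘ f))

sumList-map-1 : ∀ {A : Set} (xs : List A) → sumList (map (λ _ → 1ℚ) xs) ≡ toℚ (length xs)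
sumList-map-1 []       = refl
sumList-map-1 (_ ∷ xs) = cong (1ℚ +_) (sumList-map-1 xs)

indicator : Bool → ℚ
indicator b = if b then 1ℚ else 0ℚ

infix 4 _∈?_
_∈?_ : ∀ {K} (j : Fin K) (ws : List (Fin K)) → Dec (j ∈ ws)
_∈?_ = DecMembership._∈?_ Fin._≟_

sumFin-indicator-≡ : ∀ {K} (w : Fin K) (y : Fin K → ℚ) → sumFin (λ j → indicator (does (j Fin.≟ w)) * y j) ≡ y w
sumFin-indicator-≡ {suc K} zero y = begin
  1ℚ * y zero + sumFin (λ j → 0ℚ * y (suc j)) ≡⟨ cong₂ _+_ (ℚ.*-identityˡ (y zero)) (sumFin-cong (λ j → ℚ.*-zeroˡ (y (suc j)))) ⟩
  y zero + sumFin {K} (λ _ → 0ℚ)             ≡⟨ cong (y zero +_) (trans (sumFin-const K 0ℚ) (ℚ.*-zeroʳ (toℚ K))) ⟩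
  y zero + 0ℚ                                ≡⟨ ℚ.+-identityʳ (y zero) ⟩
  y zero                                     ∎
sumFin-indicator-≡ {suc K} (suc w) y = begin
  0ℚ * y zero + sumFin (λ j → indicator (does (suc j Fin.≟ suc w)) * y (suc j))
    ≡⟨ cong₂ _+_ (ℚ.*-zeroˡ (y zero)) (sumFin-cong (λ j → cong (λ b → indicator b * y (suc j)) (≟-suc j))) ⟩
  0ℚ + sumFin (λ j → indicator (does (j Fin.≟ w)) * y (suc j))
    ≡⟨ ℚ.+-identityˡ _ ⟩
  sumFin (λ j → indicator (does (j Fin.≟ w)) * y (suc j))
    ≡⟨ sumFin-indicator-≡ w (y ∘ suc) ⟩
  y (suc w) ∎
  where
  ≟-suc : ∀ j → does (suc j Fin.≟ suc w) ≡ does (j Fin.≟ w)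
  ≟-suc j with j Fin.≟ w
  ... | yes _ = refl
  ... | no  _ = refl

indicator-∈-∷ : ∀ {K} {w : Fin K} {ws} → w ∉ ws → ∀ j →
  indicator (does (j ∈? w ∷ ws)) ≡ indicator (does (j Fin.≟ w)) + indicator (does (j ∈? ws))
indicator-∈-∷ {w = w} {ws} w∉ws j with j Fin.≟ w | j ∈? ws
... | yes refl | yes w∈ws = ⊥-elim (w∉ws w∈ws)
... | yes refl | no  _    = refl
... | no  _    | yes _    = refl
... | no  _    | no  _    = refl

sumFin-indicator-∈ : ∀ {K} (ws : List (Fin K)) → Unique ws → ∀ (y : Fin K → ℚ) →
  sumFin (λ j → indicator (does (j ∈? ws)) * y j) ≡ sumList (map y ws)
sumFin-indicator-∈ {K} [] _ y = trans (sumFin-cong (λ j → ℚ.*-zeroˡ (y j))) (trans (sumFin-const K 0ℚ) (ℚ.*-zeroʳ (toℚ K)))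
sumFin-indicator-∈ (w ∷ ws) (w∉ws ∷ unique) y = begin
  sumFin (λ j → indicator (does (j ∈? w ∷ ws)) * y j)
    ≡⟨ sumFin-cong (λ j → trans (cong (_* y j) (indicator-∈-∷ (All.All¬⇒¬Any w∉ws) j)) (ℚ.*-distribʳ-+ (y j) (indicator (does (j Fin.≟ w))) (indicator (does (j ∈? ws))))) ⟩
  sumFin (λ j → indicator (does (j Fin.≟ w)) * y j + indicator (does (j ∈? ws)) * y j)
    ≡⟨ sumFin-+ (λ j → indicator (does (j Fin.≟ w)) * y j) (λ j → indicator (does (j ∈? ws)) * y j) ⟩
  sumFin (λ j → indicator (does (j Fin.≟ w)) * y j) + sumFin (λ j → indicator (does (j ∈? ws)) * y j)
    ≡⟨ cong₂ _+_ (sumFin-indicator-≡ w y) (sumFin-indicator-∈ ws unique y) ⟩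
  y w + sumList (map y ws) ∎

mulAdj : (G : Graph) → (Fin (order G) → ℚ) → Fin (order G) → ℚ
mulAdj G x i = sumFin (λ j → AdjMatrix G i j * x j)

degree : (G : Graph) → Fin (order G) → ℚ
degree G = mulAdj G (λ _ → 1ℚ)

module _ {G : Graph} (σ : Automorphism G) where
  open GraphIso σ

  mulAdj-automorphism : ∀ x i → mulAdj G x (to i) ≡ mulAdj G (x ∘ to) i
  mulAdj-automorphism x i = begin
    sumFin (λ j → AdjMatrix G (to i) j * x j)
      ≡⟨ sym (sumFin-permute (λ j → AdjMatrix G (to i) j * x j) to from to-from from-to) ⟩
    sumFin (λ j → AdjMatrix G (to i) (to j) * x (to j))
      ≡⟨ sumFin-cong (λ j → cong (λ b → indicator b * x (to j)) (preserves i j)) ⟩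
    sumFin (λ j → AdjMatrix G i j * x (to j)) ∎

  InKernel-automorphism : ∀ {x} → InKernel G x → InKernel G (x ∘ to)
  InKernel-automorphism {x} Ax≡0 i = trans (sym (mulAdj-automorphism x i)) (Ax≡0 (to i))

  degree-automorphism : ∀ i → degree G (to i) ≡ degree G i
  degree-automorphism = mulAdj-automorphism (λ _ → 1ℚ)

Reach-trans : ∀ {G i j k} → Reach G i j → Reach G j k → Reach G i k
Reach-trans here         r = r
Reach-trans (step a r) r′ = step a (Reach-trans r r′)

Reach-sym : ∀ {G i j} → Reach G i j → Reach G j i
Reach-sym here = here
Reach-sym {G} {i} (step {j = j} a r) = Reach-trans (Reach-sym r) (step (trans (adj-sym G j i) a) here)

GraphIso⇒order≡ : ∀ {G H} → GraphIso G H → order G ≡ order H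
GraphIso⇒order≡ iso = Fin.cantor-schröder-bernstein
  (λ {i} {j} eq → trans (sym (from-to i)) (trans (cong from eq) (from-to j)))
  (λ {i} {j} eq → trans (sym (to-from i)) (trans (cong to eq) (to-from j)))
  where open GraphIso iso

IsNut-from-full-spanning : ∀ {G} x → 2 ℕ.≤ order G → Connected G → InKernel G x → Full x →
  (∀ y → InKernel G y → ∃ λ c → ∀ i → y i ≡ c * x i) → IsNut G
IsNut-from-full-spanning {G} x 2≤order connected Ax≡0 full spans =
  2≤order , connected , (x , Ax≡0 , (i₀ , full i₀) , spans) , full-kernel
  where
  i₀ : Fin (order G)
  i₀ = fromℕ< (ℕ.≤-trans (ℕ.s≤s ℕ.z≤n) 2≤order)

  full-kernel : ∀ y → InKernel G y → NonZeroVec y → Full y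
  full-kernel y Ay≡0 (j , yj≢0) i yi≡0 with spans y Ay≡0
  ... | c , y≡cx = *-≢0 c≢0 (full i) (trans (sym (y≡cx i)) yi≡0)
    where
    c≢0 : c ≢ 0ℚ
    c≢0 c≡0 = yj≢0 (trans (y≡cx j) (trans (cong (_* x j) c≡0) (ℚ.*-zeroˡ (x j))))

record FinGroup (n : ℕ) : Set where
  infixl 7 _∙_
  infix  8 _⁻¹
  field
    _∙_     : Fin n → Fin n → Fin n
    ε       : Fin n
    _⁻¹     : Fin n → Fin n
    isGroup : IsGroup _≡_ _∙_ ε _⁻¹

  group : Group 0ℓ 0ℓ
  group = record { isGroup = isGroup }

  open IsGroup isGroup public using (assoc; identityˡ; identityʳ)
  open GroupProperties group public
    using (\\-leftDividesˡ; \\-leftDividesʳ; //-rightDividesˡ; //-rightDividesʳ; ⁻¹-involutive; ε⁻¹≈ε)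

module _ {n} (𝔾 : FinGroup n) where
  open FinGroup 𝔾

  sumFin-∙ˡ : ∀ (f : Fin n → ℚ) x → sumFin (λ i → f (x ∙ i)) ≡ sumFin f
  sumFin-∙ˡ f x = sumFin-permute f (x ∙_) (x ⁻¹ ∙_) (\\-leftDividesˡ x) (\\-leftDividesʳ x)

  sumFin-∙ˡ-⁻¹ : ∀ (f : Fin n → ℚ) x → sumFin (λ i → f (x ∙ i ⁻¹)) ≡ sumFin f
  sumFin-∙ˡ-⁻¹ f x = sumFin-permute f (λ i → x ∙ i ⁻¹) (λ j → (x ⁻¹ ∙ j) ⁻¹) left right
    where
    left : ∀ j → x ∙ ((x ⁻¹ ∙ j) ⁻¹) ⁻¹ ≡ j
    left j = trans (cong (x ∙_) (⁻¹-involutive (x ⁻¹ ∙ j))) (\\-leftDividesˡ x j)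
    right : ∀ i → (x ⁻¹ ∙ (x ∙ i ⁻¹)) ⁻¹ ≡ i
    right i = trans (cong _⁻¹ (\\-leftDividesʳ x (i ⁻¹))) (⁻¹-involutive i)

-- The gadget graphs

module Construction {n : ℕ} (𝔾 : FinGroup n) (m : ℕ) where

  open FinGroup 𝔾

  K′ : ℕ
  K′ = suc (m ℕ.+ n)

  K : ℕ
  K = suc K′

  last : Fin K
  last = fromℕ K′

  -- Colours 0, …, m+1 are ε and colour m+2+g is g; the surplus ε-colours make the order grow with m.
  colour : Fin K → Fin n
  colour k = [ (λ _ → ε) , id ] (splitAt (suc (suc m)) k)

  colour-↑ˡ : ∀ j → colour (j ↑ˡ n) ≡ ε
  colour-↑ˡ j = cong [ (λ _ → ε) , id ] (Fin.splitAt-↑ˡ (suc (suc m)) j n)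

  colour-↑ʳ : ∀ x → colour (suc (suc m) ↑ʳ x) ≡ x
  colour-↑ʳ x = cong [ (λ _ → ε) , id ] (Fin.splitAt-↑ʳ (suc (suc m)) n x)

  data Layer : Set where
    P N P′ Q Q′ R R′ : Layer
    La Lb Ya Yb B X  : Fin K → Layer

  previous : Fin K → Layer
  previous zero    = R
  previous (suc i) = Yb (inject₁ i)

  next : Fin K → Layer
  next k with view k
  ... | ‵fromℕ     = R′
  ... | ‵inj₁ {i = i} _ = La (suc i)

  next-inject₁ : ∀ i → next (inject₁ i) ≡ La (suc i)
  next-inject₁ i rewrite view-inject₁ i = refl

  next-last : next last ≡ R′
  next-last rewrite view-fromℕ K′ = refl

  Vertex : Set
  Vertex = Fin n × Layer

  copy : Vertex → Fin n
  copy = proj₁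

  layer : Vertex → Layer
  layer = proj₂

  data Link : Layer → Layer → Set where
    P-Q   : Link P Q
    P-P′  : Link P P′
    P-Ya  : ∀ k → Link P (Ya k)
    N-Q   : Link N Q
    N-Q′  : Link N Q′
    N-R   : Link N R
    N-R′  : Link N R′
    N-La  : ∀ k → Link N (La k)
    N-Lb  : ∀ k → Link N (Lb k)
    N-Yb  : ∀ k → Link N (Yb k)
    P′-Q′ : Link P′ Q′
    R-La  : Link R (La zero)
    Yb-La : ∀ i → Link (Yb (inject₁ i)) (La (suc i))
    Yb-R′ : Link (Yb last) R′
    La-Ya : ∀ k → Link (La k) (Ya k)
    La-X  : ∀ k → Link (La k) (X k)
    Lb-Ya : ∀ k → Link (Lb k) (Ya k)
    Lb-Yb : ∀ k → Link (Lb k) (Yb k)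
    Lb-X  : ∀ k → Link (Lb k) (X k)
    X-B   : ∀ k → Link (X k) (B k)

  data Arc : Vertex → Vertex → Set where
    link   : ∀ {x ℓ ℓ′} → Link ℓ ℓ′ → Arc (x , ℓ) (x , ℓ′)
    bridge : ∀ {x} k → Arc (x , P) (x ∙ colour k , B k)

  Adjacent : Vertex → Vertex → Set
  Adjacent v w = Arc v w ⊎ Arc w v

  Adjacent-sym : ∀ {v w} → Adjacent v w → Adjacent w v
  Adjacent-sym (inj₁ a) = inj₂ a
  Adjacent-sym (inj₂ a) = inj₁ a

  Link-irrefl : ∀ {ℓ} → ¬ Link ℓ ℓ
  Link-irrefl ()

  Arc-irrefl : ∀ {v} → ¬ Arc v v
  Arc-irrefl (link l) = Link-irrefl l

  Adjacent-irrefl : ∀ {v} → ¬ Adjacent v v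
  Adjacent-irrefl (inj₁ a) = Arc-irrefl a
  Adjacent-irrefl (inj₂ a) = Arc-irrefl a

  family : Fin n → (Fin K → Layer) → List Vertex
  family x f = tabulate (λ k → x , f k)

  colourNeighbours : Fin n → List Vertex
  colourNeighbours x = tabulate (λ k → x ∙ colour k , B k)

  neighbours : Vertex → List Vertex
  neighbours (x , P)    = (x , Q) ∷ (x , P′) ∷ family x Ya ++ colourNeighbours x
  neighbours (x , N)    = (x , Q) ∷ (x , Q′) ∷ (x , R) ∷ (x , R′) ∷ family x Yb ++ family x La ++ family x Lb
  neighbours (x , P′)   = (x , Q′) ∷ (x , P) ∷ []
  neighbours (x , Q)    = (x , P) ∷ (x , N) ∷ []
  neighbours (x , Q′)   = (x , P′) ∷ (x , N) ∷ []
  neighbours (x , R)    = (x , La zero) ∷ (x , N) ∷ []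
  neighbours (x , R′)   = (x , Yb last) ∷ (x , N) ∷ []
  neighbours (x , La k) = (x , previous k) ∷ (x , Ya k) ∷ (x , X k) ∷ (x , N) ∷ []
  neighbours (x , Lb k) = (x , Ya k) ∷ (x , Yb k) ∷ (x , X k) ∷ (x , N) ∷ []
  neighbours (x , Ya k) = (x , La k) ∷ (x , Lb k) ∷ (x , P) ∷ []
  neighbours (x , Yb k) = (x , Lb k) ∷ (x , next k) ∷ (x , N) ∷ []
  neighbours (x , B k)  = (x , X k) ∷ (x ∙ colour k ⁻¹ , P) ∷ []
  neighbours (x , X k)  = (x , B k) ∷ (x , La k) ∷ (x , Lb k) ∷ []

  ∈-family : ∀ x f k → (x , f k) ∈ family x f
  ∈-family x f k = ∈-tabulate⁺ {f = λ k → x , f k} k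

  ∈-family⁻ : ∀ {x} f {w} → w ∈ family x f → ∃ λ k → w ≡ (x , f k)
  ∈-family⁻ {x} f = ∈-tabulate⁻ {f = λ k → x , f k}

  ∈-colourNeighbours : ∀ x k → (x ∙ colour k , B k) ∈ colourNeighbours x
  ∈-colourNeighbours x k = ∈-tabulate⁺ {f = λ k → x ∙ colour k , B k} k

  ∈-colourNeighbours⁻ : ∀ {x w} → w ∈ colourNeighbours x → ∃ λ k → w ≡ (x ∙ colour k , B k)
  ∈-colourNeighbours⁻ {x} = ∈-tabulate⁻ {f = λ k → x ∙ colour k , B k}

  Adjacent-next : ∀ x k → Adjacent (x , Yb k) (x , next k)
  Adjacent-next x k with view k
  ... | ‵fromℕ      = inj₁ (link Yb-R′)
  ... | ‵inj₁ {i = i} _ = inj₁ (link (Yb-La i))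

  Adjacent-previous : ∀ x k → Adjacent (x , La k) (x , previous k)
  Adjacent-previous x zero    = inj₂ (link R-La)
  Adjacent-previous x (suc i) = inj₂ (link (Yb-La i))

  colour-back : ∀ x k → Arc (x ∙ colour k ⁻¹ , P) (x , B k)
  colour-back x k = subst (λ z → Arc (x ∙ colour k ⁻¹ , P) (z , B k)) (//-rightDividesˡ (colour k) x) (bridge k)

  ∈neighbours⇒Adjacent : ∀ v {w} → w ∈ neighbours v → Adjacent v w
  ∈neighbours⇒Adjacent (x , P) (here refl)                = inj₁ (link P-Q)
  ∈neighbours⇒Adjacent (x , P) (there (here refl))        = inj₁ (link P-P′)
  ∈neighbours⇒Adjacent (x , P) (there (there w∈)) with ∈-++⁻ (family x Ya) w∈
  ... | inj₁ w∈Ya with ∈-family⁻ Ya w∈Ya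
  ...   | k , refl = inj₁ (link (P-Ya k))
  ∈neighbours⇒Adjacent (x , P) (there (there w∈)) | inj₂ w∈B with ∈-colourNeighbours⁻ w∈B
  ...   | k , refl = inj₁ (bridge k)
  ∈neighbours⇒Adjacent (x , N) (here refl)                         = inj₁ (link N-Q)
  ∈neighbours⇒Adjacent (x , N) (there (here refl))                 = inj₁ (link N-Q′)
  ∈neighbours⇒Adjacent (x , N) (there (there (here refl)))         = inj₁ (link N-R)
  ∈neighbours⇒Adjacent (x , N) (there (there (there (here refl)))) = inj₁ (link N-R′)
  ∈neighbours⇒Adjacent (x , N) (there (there (there (there w∈)))) with ∈-++⁻ (family x Yb) w∈
  ... | inj₁ w∈Yb with ∈-family⁻ Yb w∈Yb
  ...   | k , refl = inj₁ (link (N-Yb k))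
  ∈neighbours⇒Adjacent (x , N) (there (there (there (there w∈)))) | inj₂ w∈L with ∈-++⁻ (family x La) w∈L
  ...   | inj₁ w∈La with ∈-family⁻ La w∈La
  ...     | k , refl = inj₁ (link (N-La k))
  ∈neighbours⇒Adjacent (x , N) (there (there (there (there w∈)))) | inj₂ w∈L | inj₂ w∈Lb with ∈-family⁻ Lb w∈Lb
  ...     | k , refl = inj₁ (link (N-Lb k))
  ∈neighbours⇒Adjacent (x , P′) (here refl)                = inj₁ (link P′-Q′)
  ∈neighbours⇒Adjacent (x , P′) (there (here refl))        = inj₂ (link P-P′)
  ∈neighbours⇒Adjacent (x , Q) (here refl)                 = inj₂ (link P-Q)
  ∈neighbours⇒Adjacent (x , Q) (there (here refl))         = inj₂ (link N-Q)
  ∈neighbours⇒Adjacent (x , Q′) (here refl)                = inj₂ (link P′-Q′)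
  ∈neighbours⇒Adjacent (x , Q′) (there (here refl))        = inj₂ (link N-Q′)
  ∈neighbours⇒Adjacent (x , R) (here refl)                 = inj₁ (link R-La)
  ∈neighbours⇒Adjacent (x , R) (there (here refl))         = inj₂ (link N-R)
  ∈neighbours⇒Adjacent (x , R′) (here refl)                = inj₂ (link Yb-R′)
  ∈neighbours⇒Adjacent (x , R′) (there (here refl))        = inj₂ (link N-R′)
  ∈neighbours⇒Adjacent (x , La k) (here refl)                         = Adjacent-previous x k
  ∈neighbours⇒Adjacent (x , La k) (there (here refl))                 = inj₁ (link (La-Ya k))
  ∈neighbours⇒Adjacent (x , La k) (there (there (here refl)))         = inj₁ (link (La-X k))
  ∈neighbours⇒Adjacent (x , La k) (there (there (there (here refl)))) = inj₂ (link (N-La k))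
  ∈neighbours⇒Adjacent (x , Lb k) (here refl)                         = inj₁ (link (Lb-Ya k))
  ∈neighbours⇒Adjacent (x , Lb k) (there (here refl))                 = inj₁ (link (Lb-Yb k))
  ∈neighbours⇒Adjacent (x , Lb k) (there (there (here refl)))         = inj₁ (link (Lb-X k))
  ∈neighbours⇒Adjacent (x , Lb k) (there (there (there (here refl)))) = inj₂ (link (N-Lb k))
  ∈neighbours⇒Adjacent (x , Ya k) (here refl)                 = inj₂ (link (La-Ya k))
  ∈neighbours⇒Adjacent (x , Ya k) (there (here refl))         = inj₂ (link (Lb-Ya k))
  ∈neighbours⇒Adjacent (x , Ya k) (there (there (here refl))) = inj₂ (link (P-Ya k))
  ∈neighbours⇒Adjacent (x , Yb k) (here refl)                 = inj₂ (link (Lb-Yb k))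
  ∈neighbours⇒Adjacent (x , Yb k) (there (here refl))         = Adjacent-next x k
  ∈neighbours⇒Adjacent (x , Yb k) (there (there (here refl))) = inj₂ (link (N-Yb k))
  ∈neighbours⇒Adjacent (x , B k) (here refl)                  = inj₂ (link (X-B k))
  ∈neighbours⇒Adjacent (x , B k) (there (here refl))          = inj₂ (colour-back x k)
  ∈neighbours⇒Adjacent (x , X k) (here refl)                  = inj₁ (link (X-B k))
  ∈neighbours⇒Adjacent (x , X k) (there (here refl))          = inj₂ (link (La-X k))
  ∈neighbours⇒Adjacent (x , X k) (there (there (here refl)))  = inj₂ (link (Lb-X k))

  Arc⇒∈neighbours : ∀ {v w} → Arc v w → w ∈ neighbours v
  Arc⇒∈neighbours {x , _} (link P-Q)         = here refl
  Arc⇒∈neighbours {x , _} (link P-P′)        = there (here refl)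
  Arc⇒∈neighbours {x , _} (link (P-Ya k))    = there (there (∈-++⁺ˡ (∈-family x Ya k)))
  Arc⇒∈neighbours {x , _} (link N-Q)         = here refl
  Arc⇒∈neighbours {x , _} (link N-Q′)        = there (here refl)
  Arc⇒∈neighbours {x , _} (link N-R)         = there (there (here refl))
  Arc⇒∈neighbours {x , _} (link N-R′)        = there (there (there (here refl)))
  Arc⇒∈neighbours {x , _} (link (N-Yb k))    = there (there (there (there (∈-++⁺ˡ (∈-family x Yb k)))))
  Arc⇒∈neighbours {x , _} (link (N-La k))    =
    there (there (there (there (∈-++⁺ʳ (family x Yb) (∈-++⁺ˡ (∈-family x La k))))))
  Arc⇒∈neighbours {x , _} (link (N-Lb k))    =
    there (there (there (there (∈-++⁺ʳ (family x Yb) (∈-++⁺ʳ (family x La) (∈-family x Lb k))))))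
  Arc⇒∈neighbours {x , _} (link P′-Q′)       = here refl
  Arc⇒∈neighbours {x , _} (link R-La)        = here refl
  Arc⇒∈neighbours {x , _} (link (Yb-La i))   = there (here (cong (x ,_) (sym (next-inject₁ i))))
  Arc⇒∈neighbours {x , _} (link Yb-R′)       = there (here (cong (x ,_) (sym next-last)))
  Arc⇒∈neighbours {x , _} (link (La-Ya k))   = there (here refl)
  Arc⇒∈neighbours {x , _} (link (La-X k))    = there (there (here refl))
  Arc⇒∈neighbours {x , _} (link (Lb-Ya k))   = here refl
  Arc⇒∈neighbours {x , _} (link (Lb-Yb k))   = there (here refl)
  Arc⇒∈neighbours {x , _} (link (Lb-X k))    = there (there (here refl))
  Arc⇒∈neighbours {x , _} (link (X-B k))     = here refl
  Arc⇒∈neighbours {x , _} (bridge k)         = there (there (∈-++⁺ʳ (family x Ya) (∈-colourNeighbours x k)))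

  Arc⇒∈neighbours⁻¹ : ∀ {v w} → Arc v w → v ∈ neighbours w
  Arc⇒∈neighbours⁻¹ {x , _} (link P-Q)        = here refl
  Arc⇒∈neighbours⁻¹ {x , _} (link P-P′)       = there (here refl)
  Arc⇒∈neighbours⁻¹ {x , _} (link (P-Ya k))   = there (there (here refl))
  Arc⇒∈neighbours⁻¹ {x , _} (link N-Q)        = there (here refl)
  Arc⇒∈neighbours⁻¹ {x , _} (link N-Q′)       = there (here refl)
  Arc⇒∈neighbours⁻¹ {x , _} (link N-R)        = there (here refl)
  Arc⇒∈neighbours⁻¹ {x , _} (link N-R′)       = there (here refl)
  Arc⇒∈neighbours⁻¹ {x , _} (link (N-Yb k))   = there (there (here refl))
  Arc⇒∈neighbours⁻¹ {x , _} (link (N-La k))   = there (there (there (here refl)))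
  Arc⇒∈neighbours⁻¹ {x , _} (link (N-Lb k))   = there (there (there (here refl)))
  Arc⇒∈neighbours⁻¹ {x , _} (link P′-Q′)      = here refl
  Arc⇒∈neighbours⁻¹ {x , _} (link R-La)       = here refl
  Arc⇒∈neighbours⁻¹ {x , _} (link (Yb-La i))  = here refl
  Arc⇒∈neighbours⁻¹ {x , _} (link Yb-R′)      = here refl
  Arc⇒∈neighbours⁻¹ {x , _} (link (La-Ya k))  = here refl
  Arc⇒∈neighbours⁻¹ {x , _} (link (La-X k))   = there (here refl)
  Arc⇒∈neighbours⁻¹ {x , _} (link (Lb-Ya k))  = there (here refl)
  Arc⇒∈neighbours⁻¹ {x , _} (link (Lb-Yb k))  = here refl
  Arc⇒∈neighbours⁻¹ {x , _} (link (Lb-X k))   = there (there (here refl))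
  Arc⇒∈neighbours⁻¹ {x , _} (link (X-B k))    = here refl
  Arc⇒∈neighbours⁻¹ {x , _} (bridge k)        = there (here (cong (_, P) (sym (//-rightDividesʳ (colour k) x))))

  Adjacent⇒∈neighbours : ∀ {v w} → Adjacent v w → w ∈ neighbours v
  Adjacent⇒∈neighbours (inj₁ a) = Arc⇒∈neighbours a
  Adjacent⇒∈neighbours (inj₂ a) = Arc⇒∈neighbours⁻¹ a

  family-fresh : ∀ {x ℓ} f → (∀ {k} → ℓ ≢ f k) → All ((x , ℓ) ≢_) (family x f)
  family-fresh {x} f ℓ≢f = All.tabulate⁺ {f = λ k → x , f k} (λ _ → ℓ≢f ∘ cong layer)

  colourNeighbours-fresh : ∀ {x ℓ} → (∀ {k} → ℓ ≢ B k) → All ((x , ℓ) ≢_) (colourNeighbours x)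
  colourNeighbours-fresh {x} ℓ≢B = All.tabulate⁺ {f = λ k → x ∙ colour k , B k} (λ _ → ℓ≢B ∘ cong layer)

  family-unique : ∀ {x} f → (∀ {i j} → f i ≡ f j → i ≡ j) → Unique (family x f)
  family-unique {x} f f-injective = Unique.tabulate⁺ {f = λ k → x , f k} (f-injective ∘ cong layer)

  colourNeighbours-unique : ∀ x → Unique (colourNeighbours x)
  colourNeighbours-unique x = Unique.tabulate⁺ {f = λ k → x ∙ colour k , B k} λ { refl → refl }

  neighbours-unique : ∀ v → Unique (neighbours v)
  neighbours-unique (x , P) =
    ((λ ()) ∷ All.++⁺ (family-fresh Ya λ ()) (colourNeighbours-fresh λ ()))
    ∷ All.++⁺ (family-fresh Ya λ ()) (colourNeighbours-fresh λ ())
    ∷ Unique.++⁺ (family-unique Ya λ { refl → refl }) (colourNeighbours-unique x) disjoint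
    where
    disjoint : ∀ {v} → ¬ (v ∈ family x Ya × v ∈ colourNeighbours x)
    disjoint (∈Ya , ∈B) with ∈-family⁻ Ya ∈Ya | ∈-colourNeighbours⁻ ∈B
    ... | _ , refl | _ , ()
  neighbours-unique (x , N) =
    ((λ ()) ∷ (λ ()) ∷ (λ ()) ∷ fresh (λ ()) (λ ()) (λ ()))
    ∷ ((λ ()) ∷ (λ ()) ∷ fresh (λ ()) (λ ()) (λ ()))
    ∷ ((λ ()) ∷ fresh (λ ()) (λ ()) (λ ()))
    ∷ fresh (λ ()) (λ ()) (λ ())
    ∷ Unique.++⁺ (family-unique Yb λ { refl → refl })
        (Unique.++⁺ (family-unique La λ { refl → refl }) (family-unique Lb λ { refl → refl }) disjoint-La-Lb)
        disjoint-Yb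
    where
    fresh : ∀ {ℓ} → (∀ {k} → ℓ ≢ Yb k) → (∀ {k} → ℓ ≢ La k) → (∀ {k} → ℓ ≢ Lb k) →
            All ((x , ℓ) ≢_) (family x Yb ++ family x La ++ family x Lb)
    fresh ≢Yb ≢La ≢Lb = All.++⁺ (family-fresh Yb ≢Yb) (All.++⁺ (family-fresh La ≢La) (family-fresh Lb ≢Lb))
    disjoint-La-Lb : ∀ {v} → ¬ (v ∈ family x La × v ∈ family x Lb)
    disjoint-La-Lb (∈La , ∈Lb) with ∈-family⁻ La ∈La | ∈-family⁻ Lb ∈Lb
    ... | _ , refl | _ , ()
    disjoint-Yb : ∀ {v} → ¬ (v ∈ family x Yb × v ∈ family x La ++ family x Lb)
    disjoint-Yb (∈Yb , ∈L) with ∈-family⁻ Yb ∈Yb | ∈-++⁻ (family x La) ∈L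
    ... | _ , refl | inj₁ ∈La with ∈-family⁻ La ∈La
    ...   | _ , ()
    disjoint-Yb (∈Yb , ∈L) | _ , refl | inj₂ ∈Lb with ∈-family⁻ Lb ∈Lb
    ...   | _ , ()
  neighbours-unique (x , P′)       = ((λ ()) ∷ []) ∷ [] ∷ []
  neighbours-unique (x , Q)        = ((λ ()) ∷ []) ∷ [] ∷ []
  neighbours-unique (x , Q′)       = ((λ ()) ∷ []) ∷ [] ∷ []
  neighbours-unique (x , R)        = ((λ ()) ∷ []) ∷ [] ∷ []
  neighbours-unique (x , R′)       = ((λ ()) ∷ []) ∷ [] ∷ []
  neighbours-unique (x , La zero)    = ((λ ()) ∷ (λ ()) ∷ (λ ()) ∷ []) ∷ ((λ ()) ∷ (λ ()) ∷ []) ∷ ((λ ()) ∷ []) ∷ [] ∷ []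
  neighbours-unique (x , La (suc i)) = ((λ ()) ∷ (λ ()) ∷ (λ ()) ∷ []) ∷ ((λ ()) ∷ (λ ()) ∷ []) ∷ ((λ ()) ∷ []) ∷ [] ∷ []
  neighbours-unique (x , Lb k)     = ((λ ()) ∷ (λ ()) ∷ (λ ()) ∷ []) ∷ ((λ ()) ∷ (λ ()) ∷ []) ∷ ((λ ()) ∷ []) ∷ [] ∷ []
  neighbours-unique (x , Ya k)     = ((λ ()) ∷ (λ ()) ∷ []) ∷ ((λ ()) ∷ []) ∷ [] ∷ []
  neighbours-unique (x , Yb k) with view k
  ... | ‵fromℕ      = ((λ ()) ∷ (λ ()) ∷ []) ∷ ((λ ()) ∷ []) ∷ [] ∷ []
  ... | ‵inj₁ _ = ((λ ()) ∷ (λ ()) ∷ []) ∷ ((λ ()) ∷ []) ∷ [] ∷ []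
  neighbours-unique (x , B k)      = ((λ ()) ∷ []) ∷ [] ∷ []
  neighbours-unique (x , X k)      = ((λ ()) ∷ (λ ()) ∷ []) ∷ ((λ ()) ∷ []) ∷ [] ∷ []

  layerCount : ℕ
  layerCount = 7 ℕ.+ 6 ℕ.* K

  Layer↔Fin : Layer ↔ Fin layerCount
  Layer↔Fin = ↔-trans (mk↔ₛ′ layer⇒⊎ ⊎⇒layer ⊎⇒layer⇒⊎ layer⇒⊎⇒layer) (↔-sym (↔-trans Fin.+↔⊎ (↔-refl ⊎-↔ Fin.*↔×)))
    where
    layer⇒⊎ : Layer → Fin 7 ⊎ Fin 6 × Fin K
    layer⇒⊎ P      = inj₁ 0F
    layer⇒⊎ N      = inj₁ 1F
    layer⇒⊎ P′     = inj₁ 2F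
    layer⇒⊎ Q      = inj₁ 3F
    layer⇒⊎ Q′     = inj₁ 4F
    layer⇒⊎ R      = inj₁ 5F
    layer⇒⊎ R′     = inj₁ 6F
    layer⇒⊎ (La k) = inj₂ (0F , k)
    layer⇒⊎ (Lb k) = inj₂ (1F , k)
    layer⇒⊎ (Ya k) = inj₂ (2F , k)
    layer⇒⊎ (Yb k) = inj₂ (3F , k)
    layer⇒⊎ (B k)  = inj₂ (4F , k)
    layer⇒⊎ (X k)  = inj₂ (5F , k)

    ⊎⇒layer : Fin 7 ⊎ Fin 6 × Fin K → Layer
    ⊎⇒layer (inj₁ 0F)       = P
    ⊎⇒layer (inj₁ 1F)       = N
    ⊎⇒layer (inj₁ 2F)       = P′
    ⊎⇒layer (inj₁ 3F)       = Q
    ⊎⇒layer (inj₁ 4F)       = Q′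
    ⊎⇒layer (inj₁ 5F)       = R
    ⊎⇒layer (inj₁ 6F)       = R′
    ⊎⇒layer (inj₂ (0F , k)) = La k
    ⊎⇒layer (inj₂ (1F , k)) = Lb k
    ⊎⇒layer (inj₂ (2F , k)) = Ya k
    ⊎⇒layer (inj₂ (3F , k)) = Yb k
    ⊎⇒layer (inj₂ (4F , k)) = B k
    ⊎⇒layer (inj₂ (5F , k)) = X k

    ⊎⇒layer⇒⊎ : ∀ s → layer⇒⊎ (⊎⇒layer s) ≡ s
    ⊎⇒layer⇒⊎ (inj₁ 0F)       = refl
    ⊎⇒layer⇒⊎ (inj₁ 1F)       = refl
    ⊎⇒layer⇒⊎ (inj₁ 2F)       = refl
    ⊎⇒layer⇒⊎ (inj₁ 3F)       = refl
    ⊎⇒layer⇒⊎ (inj₁ 4F)       = refl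
    ⊎⇒layer⇒⊎ (inj₁ 5F)       = refl
    ⊎⇒layer⇒⊎ (inj₁ 6F)       = refl
    ⊎⇒layer⇒⊎ (inj₂ (0F , k)) = refl
    ⊎⇒layer⇒⊎ (inj₂ (1F , k)) = refl
    ⊎⇒layer⇒⊎ (inj₂ (2F , k)) = refl
    ⊎⇒layer⇒⊎ (inj₂ (3F , k)) = refl
    ⊎⇒layer⇒⊎ (inj₂ (4F , k)) = refl
    ⊎⇒layer⇒⊎ (inj₂ (5F , k)) = refl

    layer⇒⊎⇒layer : ∀ ℓ → ⊎⇒layer (layer⇒⊎ ℓ) ≡ ℓ
    layer⇒⊎⇒layer P      = refl
    layer⇒⊎⇒layer N      = refl
    layer⇒⊎⇒layer P′     = refl
    layer⇒⊎⇒layer Q      = refl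
    layer⇒⊎⇒layer Q′     = refl
    layer⇒⊎⇒layer R      = refl
    layer⇒⊎⇒layer R′     = refl
    layer⇒⊎⇒layer (La k) = refl
    layer⇒⊎⇒layer (Lb k) = refl
    layer⇒⊎⇒layer (Ya k) = refl
    layer⇒⊎⇒layer (Yb k) = refl
    layer⇒⊎⇒layer (B k)  = refl
    layer⇒⊎⇒layer (X k)  = refl

  vertexCount : ℕ
  vertexCount = n ℕ.* layerCount

  Vertex↔Fin : Vertex ↔ Fin vertexCount
  Vertex↔Fin = ↔-trans (↔-refl ×-↔ Layer↔Fin) (↔-sym Fin.*↔×)

  encode : Vertex → Fin vertexCount
  encode = Inverse.to Vertex↔Fin

  decode : Fin vertexCount → Vertex
  decode = Inverse.from Vertex↔Fin

  decode-encode : ∀ v → decode (encode v) ≡ v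
  decode-encode = Inverse.strictlyInverseʳ Vertex↔Fin

  encode-decode : ∀ i → encode (decode i) ≡ i
  encode-decode = Inverse.strictlyInverseˡ Vertex↔Fin

  encode-injective : ∀ {v w} → encode v ≡ encode w → v ≡ w
  encode-injective {v} {w} eq = trans (sym (decode-encode v)) (trans (cong decode eq) (decode-encode w))

  neighbourCodes : Fin vertexCount → List (Fin vertexCount)
  neighbourCodes i = map encode (neighbours (decode i))

  Adjacent⇒∈neighbourCodes : ∀ {v w} → Adjacent v w → encode w ∈ neighbourCodes (encode v)
  Adjacent⇒∈neighbourCodes {v} {w} v∼w =
    subst (λ u → encode w ∈ map encode (neighbours u)) (sym (decode-encode v)) (∈-map⁺ encode (Adjacent⇒∈neighbours v∼w))

  ∈neighbourCodes⇒Adjacent : ∀ {i j} → j ∈ neighbourCodes i → Adjacent (decode i) (decode j)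
  ∈neighbourCodes⇒Adjacent {i} j∈ with ∈-map⁻ encode j∈
  ... | w , w∈ , refl = subst (Adjacent (decode i)) (sym (decode-encode w)) (∈neighbours⇒Adjacent (decode i) w∈)

  ∈neighbourCodes-sym : ∀ {i j} → j ∈ neighbourCodes i → i ∈ neighbourCodes j
  ∈neighbourCodes-sym {i} {j} j∈ = subst₂ (λ a b → a ∈ neighbourCodes b) (encode-decode i) (encode-decode j)
    (Adjacent⇒∈neighbourCodes (Adjacent-sym (∈neighbourCodes⇒Adjacent j∈)))

  graph : Graph
  graph = record
    { order      = vertexCount
    ; adj        = λ i j → does (j ∈? neighbourCodes i)
    ; adj-sym    = λ i j → does-⇔ (mk⇔ ∈neighbourCodes-sym ∈neighbourCodes-sym) (j ∈? neighbourCodes i) (i ∈? neighbourCodes j)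
    ; adj-irrefl = λ i → dec-false (i ∈? neighbourCodes i) (Adjacent-irrefl ∘ ∈neighbourCodes⇒Adjacent)
    }

  Adjacent⇒adj : ∀ {v w} → Adjacent v w → adj graph (encode v) (encode w) ≡ true
  Adjacent⇒adj {v} {w} v∼w = dec-true (encode w ∈? neighbourCodes (encode v)) (Adjacent⇒∈neighbourCodes v∼w)

  adj⇒Adjacent : ∀ {i j} → adj graph i j ≡ true → Adjacent (decode i) (decode j)
  adj⇒Adjacent {i} {j} ij with j ∈? neighbourCodes i
  ... | yes j∈ = ∈neighbourCodes⇒Adjacent j∈

  neighbourSum : (Vertex → ℚ) → Vertex → ℚ
  neighbourSum Y v = sumList (map Y (neighbours v))

  mulAdj-encode : ∀ (y : Fin vertexCount → ℚ) v → mulAdj graph y (encode v) ≡ neighbourSum (y ∘ encode) v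
  mulAdj-encode y v = begin
    mulAdj graph y (encode v)
      ≡⟨ sumFin-indicator-∈ (neighbourCodes (encode v)) (Unique.map⁺ encode-injective (neighbours-unique (decode (encode v)))) y ⟩
    sumList (map y (map encode (neighbours (decode (encode v)))))
      ≡⟨ cong (λ u → sumList (map y (map encode (neighbours u)))) (decode-encode v) ⟩
    sumList (map y (map encode (neighbours v)))
      ≡⟨ cong sumList (sym (List.map-∘ (neighbours v))) ⟩
    neighbourSum (y ∘ encode) v ∎

  neighbourSum-P : ∀ Y x → neighbourSum Y (x , P) ≡
    Y (x , Q) + (Y (x , P′) + (sumFin (λ k → Y (x , Ya k)) + sumFin (λ k → Y (x ∙ colour k , B k))))
  neighbourSum-P Y x = cong (λ s → Y (x , Q) + (Y (x , P′) + s)) (begin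
    sumList (map Y (family x Ya ++ colourNeighbours x))
      ≡⟨ sumList-map-++ Y (family x Ya) (colourNeighbours x) ⟩
    sumList (map Y (family x Ya)) + sumList (map Y (colourNeighbours x))
      ≡⟨ cong₂ _+_ (sumList-map-tabulate Y (λ k → x , Ya k)) (sumList-map-tabulate Y (λ k → x ∙ colour k , B k)) ⟩
    sumFin (λ k → Y (x , Ya k)) + sumFin (λ k → Y (x ∙ colour k , B k)) ∎)

  neighbourSum-N : ∀ Y x → neighbourSum Y (x , N) ≡
    Y (x , Q) + (Y (x , Q′) + (Y (x , R) + (Y (x , R′) +
      (sumFin (λ k → Y (x , Yb k)) + (sumFin (λ k → Y (x , La k)) + sumFin (λ k → Y (x , Lb k)))))))
  neighbourSum-N Y x = cong (λ s → Y (x , Q) + (Y (x , Q′) + (Y (x , R) + (Y (x , R′) + s)))) (begin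
    sumList (map Y (family x Yb ++ family x La ++ family x Lb))
      ≡⟨ sumList-map-++ Y (family x Yb) (family x La ++ family x Lb) ⟩
    sumList (map Y (family x Yb)) + sumList (map Y (family x La ++ family x Lb))
      ≡⟨ cong (sumList (map Y (family x Yb)) +_) (sumList-map-++ Y (family x La) (family x Lb)) ⟩
    sumList (map Y (family x Yb)) + (sumList (map Y (family x La)) + sumList (map Y (family x Lb)))
      ≡⟨ cong₂ _+_ (sumList-map-tabulate Y (λ k → x , Yb k))
             (cong₂ _+_ (sumList-map-tabulate Y (λ k → x , La k)) (sumList-map-tabulate Y (λ k → x , Lb k))) ⟩
    sumFin (λ k → Y (x , Yb k)) + (sumFin (λ k → Y (x , La k)) + sumFin (λ k → Y (x , Lb k))) ∎)

  -- The kernel of the adjacency matrix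

  weight : Layer → ℚ
  weight P      = 1ℚ
  weight N      = - 1ℚ
  weight P′     = 1ℚ
  weight Q      = - odd K
  weight Q′     = - 1ℚ
  weight R      = 1ℚ
  weight R′     = odd K
  weight (La k) = odd (toℕ k)
  weight (Lb k) = - toℚ (suc (suc (toℕ k ℕ.+ toℕ k)))
  weight (Ya k) = 1ℚ
  weight (Yb k) = 1ℚ
  weight (B k)  = 1ℚ
  weight (X k)  = - 1ℚ

  kernelVector : Fin vertexCount → ℚ
  kernelVector = weight ∘ layer ∘ decode

  weight-La+Lb : ∀ k → weight (La k) + weight (Lb k) ≡ - 1ℚ
  weight-La+Lb k = lemma (toℚ (toℕ k ℕ.+ toℕ k))
    where
    lemma : ∀ a → (1ℚ + a) + (- (1ℚ + (1ℚ + a))) ≡ - 1ℚ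
    lemma = solve-∀ ℚ-ring

  Lb-weight+odd-suc : ∀ a → - toℚ (suc (suc (a ℕ.+ a))) + odd (suc a) ≡ 1ℚ
  Lb-weight+odd-suc a = trans (cong (- toℚ (suc (suc (a ℕ.+ a))) +_) (odd-suc a)) (lemma (toℚ (a ℕ.+ a)))
    where
    lemma : ∀ b → - (1ℚ + (1ℚ + b)) + (1ℚ + (1ℚ + (1ℚ + b))) ≡ 1ℚ
    lemma = solve-∀ ℚ-ring

  weight-Lb+next : ∀ k → weight (Lb k) + weight (next k) ≡ 1ℚ
  weight-Lb+next k with view k
  ... | ‵fromℕ = subst (λ t → - toℚ (suc (suc (t ℕ.+ t))) + odd K ≡ 1ℚ) (sym (Fin.toℕ-fromℕ K′)) (Lb-weight+odd-suc K′)
  ... | ‵inj₁ {i = i} _ = subst (λ t → - toℚ (suc (suc (t ℕ.+ t))) + odd (suc (toℕ i)) ≡ 1ℚ)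
                            (sym (Fin.toℕ-inject₁ i)) (Lb-weight+odd-suc (toℕ i))

  weightᵥ : Vertex → ℚ
  weightᵥ = weight ∘ layer

  weight-balanced : ∀ v → neighbourSum weightᵥ v ≡ 0ℚ
  weight-balanced (x , P) = begin
    neighbourSum weightᵥ (x , P)
      ≡⟨ neighbourSum-P weightᵥ x ⟩
    - odd K + (1ℚ + (sumFin {K} (λ _ → 1ℚ) + sumFin {K} (λ _ → 1ℚ)))
      ≡⟨ cong₂ (λ a s → - (1ℚ + a) + (1ℚ + s)) (toℚ-+ K K) (cong₂ _+_ (sumFin-const K 1ℚ) (sumFin-const K 1ℚ)) ⟩
    - (1ℚ + (toℚ K + toℚ K)) + (1ℚ + (toℚ K * 1ℚ + toℚ K * 1ℚ))
      ≡⟨ lemma (toℚ K) ⟩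
    0ℚ ∎
    where
    lemma : ∀ a → - (1ℚ + (a + a)) + (1ℚ + (a * 1ℚ + a * 1ℚ)) ≡ 0ℚ
    lemma = solve-∀ ℚ-ring
  weight-balanced (x , N) = begin
    neighbourSum weightᵥ (x , N)
      ≡⟨ neighbourSum-N weightᵥ x ⟩
    - odd K + (- 1ℚ + (1ℚ + (odd K + (sumFin {K} (λ _ → 1ℚ) + (sumFin (weight ∘ La) + sumFin (weight ∘ Lb))))))
      ≡⟨ cong (λ s → - odd K + (- 1ℚ + (1ℚ + (odd K + (sumFin {K} (λ _ → 1ℚ) + s))))) (sym (sumFin-+ (weight ∘ La) (weight ∘ Lb))) ⟩
    - odd K + (- 1ℚ + (1ℚ + (odd K + (sumFin {K} (λ _ → 1ℚ) + sumFin (λ k → weight (La k) + weight (Lb k))))))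
      ≡⟨ cong₂ (λ a s → - odd K + (- 1ℚ + (1ℚ + (odd K + (a + s))))) (sumFin-const K 1ℚ)
           (trans (sumFin-cong weight-La+Lb) (sumFin-const K (- 1ℚ))) ⟩
    - odd K + (- 1ℚ + (1ℚ + (odd K + (toℚ K * 1ℚ + toℚ K * - 1ℚ))))
      ≡⟨ lemma (odd K) (toℚ K) ⟩
    0ℚ ∎
    where
    lemma : ∀ a b → - a + (- 1ℚ + (1ℚ + (a + (b * 1ℚ + b * - 1ℚ)))) ≡ 0ℚ
    lemma = solve-∀ ℚ-ring
  weight-balanced (x , P′)      = refl
  weight-balanced (x , Q)       = refl
  weight-balanced (x , Q′)      = refl
  weight-balanced (x , R)       = refl
  weight-balanced (x , R′)      = refl
  weight-balanced (x , La zero)    = refl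
  weight-balanced (x , La (suc i)) = refl
  weight-balanced (x , Lb k)    = refl
  weight-balanced (x , Ya k)    = trans (sym (ℚ.+-assoc (weight (La k)) (weight (Lb k)) (1ℚ + 0ℚ))) (cong (_+ (1ℚ + 0ℚ)) (weight-La+Lb k))
  weight-balanced (x , Yb k)    = trans (sym (ℚ.+-assoc (weight (Lb k)) (weight (next k)) (- 1ℚ + 0ℚ))) (cong (_+ (- 1ℚ + 0ℚ)) (weight-Lb+next k))
  weight-balanced (x , B k)     = refl
  weight-balanced (x , X k)     = cong (1ℚ +_) (trans (sym (ℚ.+-assoc (weight (La k)) (weight (Lb k)) 0ℚ)) (cong (_+ 0ℚ) (weight-La+Lb k)))

  kernelVector-kernel : InKernel graph kernelVector
  kernelVector-kernel i = begin
    mulAdj graph kernelVector i                  ≡⟨ cong (mulAdj graph kernelVector) (sym (encode-decode i)) ⟩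
    mulAdj graph kernelVector (encode (decode i)) ≡⟨ mulAdj-encode kernelVector (decode i) ⟩
    neighbourSum (kernelVector ∘ encode) (decode i) ≡⟨ cong sumList (List.map-cong (cong weightᵥ ∘ decode-encode) (neighbours (decode i))) ⟩
    neighbourSum weightᵥ (decode i)              ≡⟨ weight-balanced (decode i) ⟩
    0ℚ ∎

  sumFin-colour : ∀ (h : Fin n → ℚ) → sumFin (λ k → h (colour k)) ≡ toℚ (suc (suc m)) * h ε + sumFin h
  sumFin-colour h = trans (sumFin-↑ (suc (suc m)) n (h ∘ colour))
    (cong₂ _+_ (trans (sumFin-cong (cong h ∘ colour-↑ˡ)) (sumFin-const (suc (suc m)) (h ε)))
               (sumFin-cong (cong h ∘ colour-↑ʳ)))

  module Spanning (y : Fin vertexCount → ℚ) (y-kernel : InKernel graph y) where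

    Y : Vertex → ℚ
    Y = y ∘ encode

    balanced : ∀ v → neighbourSum Y v ≡ 0ℚ
    balanced v = trans (sym (mulAdj-encode y v)) (y-kernel (encode v))

    g : Fin n → ℚ
    g x = Y (x , P)

    Y-N : ∀ x → Y (x , N) ≡ - g x
    Y-N x = linear-combination (diff≡0 (balanced (x , Q)) 1ℚ) (lemma (g x) (Y (x , N)))
      where
      lemma : ∀ G nv → nv ≡ - G + ((G + (nv + 0ℚ)) + - 0ℚ) * 1ℚ
      lemma = solve-∀ ℚ-ring

    Y+Y-N≡0⇒Y≡g : ∀ x ℓ → Y (x , ℓ) + (Y (x , N) + 0ℚ) ≡ 0ℚ → Y (x , ℓ) ≡ g x
    Y+Y-N≡0⇒Y≡g x ℓ h = linear-combination (diff≡0 h 1ℚ +₀ diff≡0 (Y-N x) (- 1ℚ)) (lemma (g x) (Y (x , ℓ)) (Y (x , N)))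
      where
      lemma : ∀ G a nv → a ≡ G + (((a + (nv + 0ℚ)) + - 0ℚ) * 1ℚ + (nv + - (- G)) * (- 1ℚ))
      lemma = solve-∀ ℚ-ring

    Y-P′ : ∀ x → Y (x , P′) ≡ g x
    Y-P′ x = Y+Y-N≡0⇒Y≡g x P′ (balanced (x , Q′))

    Y-Q′ : ∀ x → Y (x , Q′) ≡ - g x
    Y-Q′ x = linear-combination (diff≡0 (balanced (x , P′)) 1ℚ) (lemma (Y (x , Q′)) (g x))
      where
      lemma : ∀ a G → a ≡ - G + ((a + (G + 0ℚ)) + - 0ℚ) * 1ℚ
      lemma = solve-∀ ℚ-ring

    Y-La⇒Y-Lb : ∀ x k → Y (x , La k) ≡ weight (La k) * g x → Y (x , Lb k) ≡ weight (Lb k) * g x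
    Y-La⇒Y-Lb x k La-value = linear-combination (diff≡0 (balanced (x , Ya k)) 1ℚ +₀ diff≡0 La-value (- 1ℚ))
                      (lemma (g x) (toℚ (toℕ k ℕ.+ toℕ k)) (Y (x , La k)) (Y (x , Lb k)))
      where
      lemma : ∀ G A a b → b ≡ (- (1ℚ + (1ℚ + A))) * G + (((a + (b + (G + 0ℚ))) + - 0ℚ) * 1ℚ + (a + - ((1ℚ + A) * G)) * (- 1ℚ))
      lemma = solve-∀ ℚ-ring

    Y-Lb⇒Y-La-suc : ∀ x i → Y (x , Lb (inject₁ i)) ≡ weight (Lb (inject₁ i)) * g x → Y (x , La (suc i)) ≡ weight (La (suc i)) * g x
    Y-Lb⇒Y-La-suc x i Y-Lb-i = trans (linear-combination
        (diff≡0 balanced-Yb 1ℚ +₀ diff≡0 Y-Lb-i′ (- 1ℚ) +₀ diff≡0 (Y-N x) (- 1ℚ))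
        (lemma (g x) (toℚ (toℕ i ℕ.+ toℕ i)) (Y (x , Lb (inject₁ i))) (Y (x , La (suc i))) (Y (x , N))))
      (cong (_* g x) (sym (odd-suc (toℕ i))))
      where
      balanced-Yb : Y (x , Lb (inject₁ i)) + (Y (x , La (suc i)) + (Y (x , N) + 0ℚ)) ≡ 0ℚ
      balanced-Yb = subst (λ ℓ → Y (x , Lb (inject₁ i)) + (Y (x , ℓ) + (Y (x , N) + 0ℚ)) ≡ 0ℚ) (next-inject₁ i) (balanced (x , Yb (inject₁ i)))
      Y-Lb-i′ : Y (x , Lb (inject₁ i)) ≡ (- (1ℚ + (1ℚ + toℚ (toℕ i ℕ.+ toℕ i)))) * g x
      Y-Lb-i′ = trans Y-Lb-i (cong (λ t → (- toℚ (suc (suc (t ℕ.+ t)))) * g x) (Fin.toℕ-inject₁ i))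
      lemma : ∀ G A b c nv → c ≡ (1ℚ + (1ℚ + (1ℚ + A))) * G + (((b + (c + (nv + 0ℚ))) + - 0ℚ) * 1ℚ
                + ((b + - ((- (1ℚ + (1ℚ + A))) * G)) * (- 1ℚ) + (nv + - (- G)) * (- 1ℚ)))
      lemma = solve-∀ ℚ-ring

    Y-La : ∀ x k → Y (x , La k) ≡ weight (La k) * g x
    Y-La x = <-weakInduction (λ k → Y (x , La k) ≡ weight (La k) * g x)
      (trans (Y+Y-N≡0⇒Y≡g x (La zero) (balanced (x , R))) (sym (ℚ.*-identityˡ (g x))))
      (λ i Y-La-i → Y-Lb⇒Y-La-suc x i (Y-La⇒Y-Lb x (inject₁ i) Y-La-i))

    Y-Lb : ∀ x k → Y (x , Lb k) ≡ weight (Lb k) * g x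
    Y-Lb x k = Y-La⇒Y-Lb x k (Y-La x k)

    Y-B : ∀ x k → Y (x , B k) ≡ g x
    Y-B x k = linear-combination
      (diff≡0 (balanced (x , X k)) 1ℚ +₀ diff≡0 (Y-La x k) (- 1ℚ) +₀ diff≡0 (Y-Lb x k) (- 1ℚ))
      (lemma (g x) (toℚ (toℕ k ℕ.+ toℕ k)) (Y (x , B k)) (Y (x , La k)) (Y (x , Lb k)))
      where
      lemma : ∀ G A b a a′ → b ≡ G + (((b + (a + (a′ + 0ℚ))) + - 0ℚ) * 1ℚ
                + ((a + - ((1ℚ + A) * G)) * (- 1ℚ) + (a′ + - ((- (1ℚ + (1ℚ + A))) * G)) * (- 1ℚ)))
      lemma = solve-∀ ℚ-ring

    -- Comparing the balance at La k and at Lb k, which share the neighbours Ya k, X k and N.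
    Y-Yb-previous : ∀ x k → Y (x , Yb k) ≡ Y (x , previous k)
    Y-Yb-previous x k = linear-combination
      (diff≡0 (balanced (x , Lb k)) 1ℚ +₀ diff≡0 (balanced (x , La k)) (- 1ℚ))
      (lemma (Y (x , previous k)) (Y (x , Ya k)) (Y (x , Yb k)) (Y (x , X k)) (Y (x , N)))
      where
      lemma : ∀ p ya yb xk nv → yb ≡ p + (((ya + (yb + (xk + (nv + 0ℚ)))) + - 0ℚ) * 1ℚ
                + ((p + (ya + (xk + (nv + 0ℚ)))) + - 0ℚ) * (- 1ℚ))
      lemma = solve-∀ ℚ-ring

    Y-Yb≡Y-R : ∀ x k → Y (x , Yb k) ≡ Y (x , R)
    Y-Yb≡Y-R x = <-weakInduction (λ k → Y (x , Yb k) ≡ Y (x , R)) (Y-Yb-previous x zero)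
      (λ i Yb-i≡R → trans (Y-Yb-previous x (suc i)) Yb-i≡R)

    Y-R : ∀ x → Y (x , R) ≡ g x
    Y-R x = trans (sym (Y-Yb≡Y-R x last)) (Y+Y-N≡0⇒Y≡g x (Yb last) (balanced (x , R′)))

    Y-Yb : ∀ x k → Y (x , Yb k) ≡ g x
    Y-Yb x k = trans (Y-Yb≡Y-R x k) (Y-R x)

    Y-X : ∀ x k → Y (x , X k) ≡ - g (x ∙ colour k ⁻¹)
    Y-X x k = linear-combination (diff≡0 (balanced (x , B k)) 1ℚ) (lemma (Y (x , X k)) (g (x ∙ colour k ⁻¹)))
      where
      lemma : ∀ a H → a ≡ - H + ((a + (H + 0ℚ)) + - 0ℚ) * 1ℚ
      lemma = solve-∀ ℚ-ring

    Y-Ya : ∀ x k → Y (x , Ya k) ≡ g (x ∙ colour k ⁻¹)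
    Y-Ya x k = linear-combination
      (diff≡0 (balanced (x , Lb k)) 1ℚ +₀ diff≡0 (Y-Yb x k) (- 1ℚ) +₀ diff≡0 (Y-X x k) (- 1ℚ) +₀ diff≡0 (Y-N x) (- 1ℚ))
      (lemma (g x) (g (x ∙ colour k ⁻¹)) (Y (x , Ya k)) (Y (x , Yb k)) (Y (x , X k)) (Y (x , N)))
      where
      lemma : ∀ G H ya yb xk nv → ya ≡ H + (((ya + (yb + (xk + (nv + 0ℚ)))) + - 0ℚ) * 1ℚ
                + ((yb + - G) * (- 1ℚ) + ((xk + - (- H)) * (- 1ℚ) + (nv + - (- G)) * (- 1ℚ))))
      lemma = solve-∀ ℚ-ring

    Y-R′ : ∀ x → Y (x , R′) ≡ weight R′ * g x
    Y-R′ x = trans (linear-combination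
        (diff≡0 balanced-Yb 1ℚ +₀ diff≡0 Y-Lb-last (- 1ℚ) +₀ diff≡0 (Y-N x) (- 1ℚ))
        (lemma (g x) (toℚ (K′ ℕ.+ K′)) (Y (x , Lb last)) (Y (x , R′)) (Y (x , N))))
      (cong (_* g x) (sym (odd-suc K′)))
      where
      balanced-Yb : Y (x , Lb last) + (Y (x , R′) + (Y (x , N) + 0ℚ)) ≡ 0ℚ
      balanced-Yb = subst (λ ℓ → Y (x , Lb last) + (Y (x , ℓ) + (Y (x , N) + 0ℚ)) ≡ 0ℚ) next-last (balanced (x , Yb last))
      Y-Lb-last : Y (x , Lb last) ≡ (- (1ℚ + (1ℚ + toℚ (K′ ℕ.+ K′)))) * g x
      Y-Lb-last = trans (Y-Lb x last) (cong (λ t → (- toℚ (suc (suc (t ℕ.+ t)))) * g x) (Fin.toℕ-fromℕ K′))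
      lemma : ∀ G A b c nv → c ≡ (1ℚ + (1ℚ + (1ℚ + A))) * G + (((b + (c + (nv + 0ℚ))) + - 0ℚ) * 1ℚ
                + ((b + - ((- (1ℚ + (1ℚ + A))) * G)) * (- 1ℚ) + (nv + - (- G)) * (- 1ℚ)))
      lemma = solve-∀ ℚ-ring

    Y-La+Lb : ∀ x k → Y (x , La k) + Y (x , Lb k) ≡ - g x
    Y-La+Lb x k = begin
      Y (x , La k) + Y (x , Lb k)                   ≡⟨ cong₂ _+_ (Y-La x k) (Y-Lb x k) ⟩
      weight (La k) * g x + weight (Lb k) * g x     ≡⟨ sym (ℚ.*-distribʳ-+ (g x) (weight (La k)) (weight (Lb k))) ⟩
      (weight (La k) + weight (Lb k)) * g x         ≡⟨ cong (_* g x) (weight-La+Lb k) ⟩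
      - 1ℚ * g x                                    ≡⟨ lemma (g x) ⟩
      - g x                                         ∎
      where
      lemma : ∀ G → - 1ℚ * G ≡ - G
      lemma = solve-∀ ℚ-ring

    Y-Q : ∀ x → Y (x , Q) ≡ weight Q * g x
    Y-Q x = linear-combination
      (diff≡0 balanced-N 1ℚ +₀ diff≡0 (Y-Q′ x) (- 1ℚ) +₀ diff≡0 (Y-R x) (- 1ℚ)
        +₀ diff≡0 (Y-R′ x) (- 1ℚ) +₀ diff≡0 sum-Yb (- 1ℚ) +₀ diff≡0 sum-La+Lb (- 1ℚ))
      (lemma (g x) (odd K) (toℚ K) (Y (x , Q)) (Y (x , Q′)) (Y (x , R)) (Y (x , R′)) sYb sL)
      where
      sYb = sumFin (λ k → Y (x , Yb k))
      sL  = sumFin (λ k → Y (x , La k)) + sumFin (λ k → Y (x , Lb k))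
      balanced-N : Y (x , Q) + (Y (x , Q′) + (Y (x , R) + (Y (x , R′) + (sYb + sL)))) ≡ 0ℚ
      balanced-N = trans (sym (neighbourSum-N Y x)) (balanced (x , N))
      sum-Yb : sYb ≡ toℚ K * g x
      sum-Yb = trans (sumFin-cong (Y-Yb x)) (sumFin-const K (g x))
      sum-La+Lb : sL ≡ toℚ K * (- g x)
      sum-La+Lb = trans (sym (sumFin-+ (λ k → Y (x , La k)) (λ k → Y (x , Lb k))))
                    (trans (sumFin-cong (Y-La+Lb x)) (sumFin-const K (- g x)))
      lemma : ∀ G V κ q q′ r r′ sYb sL → q ≡ (- V) * G + (((q + (q′ + (r + (r′ + (sYb + sL))))) + - 0ℚ) * 1ℚ
                + ((q′ + - (- G)) * (- 1ℚ) + ((r + - G) * (- 1ℚ) + ((r′ + - (V * G)) * (- 1ℚ)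
                + ((sYb + - (κ * G)) * (- 1ℚ) + (sL + - (κ * (- G))) * (- 1ℚ))))))
      lemma = solve-∀ ℚ-ring

    Σg : ℚ
    Σg = sumFin g

    M : ℚ
    M = toℚ (suc (suc m))

    sum-Ya : ∀ x → sumFin (λ k → Y (x , Ya k)) ≡ M * g x + Σg
    sum-Ya x = trans (sumFin-cong (Y-Ya x))
      (trans (sumFin-colour (λ c → g (x ∙ c ⁻¹)))
        (cong₂ (λ a b → M * a + b) (cong g (trans (cong (x ∙_) ε⁻¹≈ε) (identityʳ x))) (sumFin-∙ˡ-⁻¹ 𝔾 g x)))

    sum-B : ∀ x → sumFin (λ k → Y (x ∙ colour k , B k)) ≡ M * g x + Σg
    sum-B x = trans (sumFin-cong (λ k → Y-B (x ∙ colour k) k))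
      (trans (sumFin-colour (λ c → g (x ∙ c)))
        (cong₂ (λ a b → M * a + b) (cong g (identityʳ x)) (sumFin-∙ˡ 𝔾 g x)))

    -- The balance at P, after substituting everything else: both colour sums equal M·g x + Σg,
    -- and Q carries −(2K+1)·g x with K = M + n, leaving n·g x = Σg.
    n·g≡Σg : ∀ x → toℚ n * g x + toℚ n * g x ≡ Σg + Σg
    n·g≡Σg x = linear-combination
      (diff≡0 balanced-P (- 1ℚ) +₀ diff≡0 (Y-Q x) 1ℚ +₀ diff≡0 (Y-P′ x) 1ℚ
        +₀ diff≡0 (sum-Ya x) 1ℚ +₀ diff≡0 (sum-B x) 1ℚ +₀ diff≡0 2K≡2M+2n (- g x))
      (lemma (g x) Σg M (toℚ n) (toℚ (K ℕ.+ K)) (Y (x , Q)) (Y (x , P′)) sYa sB)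
      where
      sYa = sumFin (λ k → Y (x , Ya k))
      sB  = sumFin (λ k → Y (x ∙ colour k , B k))
      balanced-P : Y (x , Q) + (Y (x , P′) + (sYa + sB)) ≡ 0ℚ
      balanced-P = trans (sym (neighbourSum-P Y x)) (balanced (x , P))
      2K≡2M+2n : toℚ (K ℕ.+ K) ≡ (M + toℚ n) + (M + toℚ n)
      2K≡2M+2n = trans (toℚ-+ K K) (cong₂ _+_ (toℚ-+ (suc (suc m)) n) (toℚ-+ (suc (suc m)) n))
      lemma : ∀ G S M ν κ q p′ sYa sB → ν * G + ν * G ≡ (S + S) + (((q + (p′ + (sYa + sB))) + - 0ℚ) * (- 1ℚ)
                + ((q + - ((- (1ℚ + κ)) * G)) * 1ℚ + ((p′ + - G) * 1ℚ + ((sYa + - (M * G + S)) * 1ℚ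
                + ((sB + - (M * G + S)) * 1ℚ + (κ + - ((M + ν) + (M + ν))) * (- G))))))
      lemma = solve-∀ ℚ-ring

    g-constant : ∀ x → g x ≡ g ε
    g-constant x = *-cancelˡ-≢0 (g x) (g ε) (toℚ-≢0 ε)
      (*-cancelˡ-≢0 (toℚ n * g x) (toℚ n * g ε) (toℚ-suc≢0 1)
        (trans (double (toℚ n * g x)) (trans (trans (n·g≡Σg x) (sym (n·g≡Σg ε))) (sym (double (toℚ n * g ε))))))
      where
      double : ∀ a → toℚ 2 * a ≡ a + a
      double = solve-∀ ℚ-ring

    ≡1*c : ∀ {a} → a ≡ g ε → a ≡ 1ℚ * g ε
    ≡1*c a≡c = trans a≡c (sym (ℚ.*-identityˡ (g ε)))

    ≡-1*c : ∀ {a} → a ≡ g ε → - a ≡ - 1ℚ * g ε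
    ≡-1*c a≡c = trans (cong -_ (≡1*c a≡c)) (ℚ.neg-distribˡ-* 1ℚ (g ε))

    Y≡weight*c : ∀ v → Y v ≡ weightᵥ v * g ε
    Y≡weight*c (x , P)    = ≡1*c (g-constant x)
    Y≡weight*c (x , N)    = trans (Y-N x) (≡-1*c (g-constant x))
    Y≡weight*c (x , P′)   = trans (Y-P′ x) (≡1*c (g-constant x))
    Y≡weight*c (x , Q)    = trans (Y-Q x) (cong (weight Q *_) (g-constant x))
    Y≡weight*c (x , Q′)   = trans (Y-Q′ x) (≡-1*c (g-constant x))
    Y≡weight*c (x , R)    = trans (Y-R x) (≡1*c (g-constant x))
    Y≡weight*c (x , R′)   = trans (Y-R′ x) (cong (weight R′ *_) (g-constant x))
    Y≡weight*c (x , La k) = trans (Y-La x k) (cong (weight (La k) *_) (g-constant x))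
    Y≡weight*c (x , Lb k) = trans (Y-Lb x k) (cong (weight (Lb k) *_) (g-constant x))
    Y≡weight*c (x , Ya k) = trans (Y-Ya x k) (≡1*c (g-constant _))
    Y≡weight*c (x , Yb k) = trans (Y-Yb x k) (≡1*c (g-constant x))
    Y≡weight*c (x , B k)  = trans (Y-B x k) (≡1*c (g-constant x))
    Y≡weight*c (x , X k)  = trans (Y-X x k) (≡-1*c (g-constant _))

    y≡c*kernelVector : ∀ i → y i ≡ g ε * kernelVector i
    y≡c*kernelVector i = trans (cong y (sym (encode-decode i))) (trans (Y≡weight*c (decode i)) (ℚ.*-comm (weightᵥ (decode i)) (g ε)))

  weight≢0 : ∀ ℓ → weight ℓ ≢ 0ℚ
  weight≢0 P      = ℚ.1≢0
  weight≢0 N      = neg-≢0 ℚ.1≢0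
  weight≢0 P′     = ℚ.1≢0
  weight≢0 Q      = neg-≢0 (toℚ-suc≢0 (K ℕ.+ K))
  weight≢0 Q′     = neg-≢0 ℚ.1≢0
  weight≢0 R      = ℚ.1≢0
  weight≢0 R′     = toℚ-suc≢0 (K ℕ.+ K)
  weight≢0 (La k) = toℚ-suc≢0 (toℕ k ℕ.+ toℕ k)
  weight≢0 (Lb k) = neg-≢0 (toℚ-suc≢0 (suc (toℕ k ℕ.+ toℕ k)))
  weight≢0 (Ya k) = ℚ.1≢0
  weight≢0 (Yb k) = ℚ.1≢0
  weight≢0 (B k)  = ℚ.1≢0
  weight≢0 (X k)  = neg-≢0 ℚ.1≢0

  path : ∀ {v w u} → Adjacent v w → Reach graph (encode w) u → Reach graph (encode v) u
  path v∼w = step (Adjacent⇒adj v∼w)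

  N-reaches-P : ∀ x → Reach graph (encode (x , N)) (encode (x , P))
  N-reaches-P x = path (inj₁ (link N-Q)) (path (inj₂ (link P-Q)) here)

  reaches-P : ∀ v → Reach graph (encode v) (encode (copy v , P))
  reaches-P (x , P)    = here
  reaches-P (x , N)    = N-reaches-P x
  reaches-P (x , P′)   = path (inj₂ (link P-P′)) here
  reaches-P (x , Q)    = path (inj₂ (link P-Q)) here
  reaches-P (x , Q′)   = path (inj₂ (link P′-Q′)) (path (inj₂ (link P-P′)) here)
  reaches-P (x , R)    = path (inj₂ (link N-R)) (N-reaches-P x)
  reaches-P (x , R′)   = path (inj₂ (link N-R′)) (N-reaches-P x)
  reaches-P (x , La k) = path (inj₂ (link (N-La k))) (N-reaches-P x)
  reaches-P (x , Lb k) = path (inj₂ (link (N-Lb k))) (N-reaches-P x)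
  reaches-P (x , Ya k) = path (inj₂ (link (P-Ya k))) here
  reaches-P (x , Yb k) = path (inj₂ (link (N-Yb k))) (N-reaches-P x)
  reaches-P (x , B k)  = path (inj₂ (link (X-B k))) (path (inj₂ (link (La-X k))) (path (inj₂ (link (N-La k))) (N-reaches-P x)))
  reaches-P (x , X k)  = path (inj₂ (link (La-X k))) (path (inj₂ (link (N-La k))) (N-reaches-P x))

  P-reaches-P : ∀ x z → Reach graph (encode (x , P)) (encode (z , P))
  P-reaches-P x z = subst (λ u → Reach graph (encode (x , P)) (encode (u , P))) x∙colour≡z
    (path (inj₁ (bridge k)) (reaches-P (x ∙ colour k , B k)))
    where
    k = suc (suc m) ↑ʳ (x ⁻¹ ∙ z)
    x∙colour≡z : x ∙ colour k ≡ z
    x∙colour≡z = trans (cong (x ∙_) (colour-↑ʳ (x ⁻¹ ∙ z))) (\\-leftDividesˡ x z)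

  graph-connected : Connected graph
  graph-connected i j = subst₂ (Reach graph) (encode-decode i) (encode-decode j)
    (Reach-trans (reaches-P (decode i))
      (Reach-trans (P-reaches-P (copy (decode i)) (copy (decode j))) (Reach-sym (reaches-P (decode j)))))

  2≤vertexCount : 2 ℕ.≤ vertexCount
  2≤vertexCount = 2≤*layerCount ε
    where
    2≤*layerCount : ∀ {a} → Fin a → 2 ℕ.≤ a ℕ.* layerCount
    2≤*layerCount {suc a} _ = ℕ.≤-trans (ℕ.s≤s (ℕ.s≤s ℕ.z≤n)) (ℕ.m≤m+n layerCount (a ℕ.* layerCount))

  graph-IsNut : IsNut graph
  graph-IsNut = IsNut-from-full-spanning kernelVector 2≤vertexCount graph-connected kernelVector-kernel
    (weight≢0 ∘ layer ∘ decode) (λ y y-kernel → Spanning.g y y-kernel ε , Spanning.y≡c*kernelVector y y-kernel)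

  -- Automorphisms

  translate : Fin n → Vertex → Vertex
  translate a (x , ℓ) = (a ∙ x , ℓ)

  translate-Arc : ∀ a {v w} → Arc v w → Arc (translate a v) (translate a w)
  translate-Arc a (link l)         = link l
  translate-Arc a (bridge {x} k)   = subst (λ z → Arc (a ∙ x , P) (z , B k)) (assoc a x (colour k)) (bridge k)

  translate-Adjacent : ∀ a {v w} → Adjacent v w → Adjacent (translate a v) (translate a w)
  translate-Adjacent a (inj₁ vw) = inj₁ (translate-Arc a vw)
  translate-Adjacent a (inj₂ wv) = inj₂ (translate-Arc a wv)

  translate-⁻¹ : ∀ a v → translate (a ⁻¹) (translate a v) ≡ v
  translate-⁻¹ a (x , ℓ) = cong (_, ℓ) (\\-leftDividesʳ a x)

  translate-∙ : ∀ a b v → translate (a ∙ b) v ≡ translate a (translate b v)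
  translate-∙ a b (x , ℓ) = cong (_, ℓ) (assoc a b x)

  translation : Fin n → Fin vertexCount → Fin vertexCount
  translation a = encode ∘ translate a ∘ decode

  translation-⁻¹ : ∀ a i → translation (a ⁻¹) (translation a i) ≡ i
  translation-⁻¹ a i = begin
    encode (translate (a ⁻¹) (decode (encode (translate a (decode i))))) ≡⟨ cong (encode ∘ translate (a ⁻¹)) (decode-encode (translate a (decode i))) ⟩
    encode (translate (a ⁻¹) (translate a (decode i)))                   ≡⟨ cong encode (translate-⁻¹ a (decode i)) ⟩
    encode (decode i)                                                    ≡⟨ encode-decode i ⟩
    i                                                                    ∎

  translation-∙ : ∀ a b i → translation (a ∙ b) i ≡ translation a (translation b i)
  translation-∙ a b i = begin
    encode (translate (a ∙ b) (decode i))                    ≡⟨ cong encode (translate-∙ a b (decode i)) ⟩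
    encode (translate a (translate b (decode i)))            ≡⟨ cong (encode ∘ translate a) (sym (decode-encode (translate b (decode i)))) ⟩
    encode (translate a (decode (translation b i)))          ∎

  translation-∈neighbourCodes : ∀ a {i j} → j ∈ neighbourCodes i → translation a j ∈ neighbourCodes (translation a i)
  translation-∈neighbourCodes a j∈ = Adjacent⇒∈neighbourCodes (translate-Adjacent a (∈neighbourCodes⇒Adjacent j∈))

  translation-automorphism : Fin n → Automorphism graph
  translation-automorphism a = record
    { to        = translation a
    ; from      = translation (a ⁻¹)
    ; from-to   = translation-⁻¹ a
    ; to-from   = λ i → subst (λ b → translation b (translation (a ⁻¹) i) ≡ i) (⁻¹-involutive a) (translation-⁻¹ (a ⁻¹) i)
    ; preserves = λ i j → does-⇔ (mk⇔ (reflect i j) (translation-∈neighbourCodes a))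
                    (translation a j ∈? neighbourCodes (translation a i)) (j ∈? neighbourCodes i)
    }
    where
    reflect : ∀ i j → translation a j ∈ neighbourCodes (translation a i) → j ∈ neighbourCodes i
    reflect i j Tj∈ = subst₂ (λ u v → v ∈ neighbourCodes u) (translation-⁻¹ a i) (translation-⁻¹ a j)
      (translation-∈neighbourCodes (a ⁻¹) Tj∈)

  translation-injective : ∀ {a b} → (∀ i → translation a i ≡ translation b i) → a ≡ b
  translation-injective {a} {b} a≗b = begin
    a      ≡⟨ sym (identityʳ a) ⟩
    a ∙ ε  ≡⟨ cong copy (encode-injective {a ∙ ε , P} {b ∙ ε , P} at-εP) ⟩
    b ∙ ε  ≡⟨ identityʳ b ⟩
    b      ∎
    where
    at-εP : encode (translate a (ε , P)) ≡ encode (translate b (ε , P))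
    at-εP = subst (λ u → encode (translate a u) ≡ encode (translate b u)) (decode-encode (ε , P)) (a≗b (encode (ε , P)))

  deg : Layer → ℕ
  deg P      = suc (suc (K ℕ.+ K))
  deg N      = suc (suc (suc (suc (K ℕ.+ (K ℕ.+ K)))))
  deg P′     = 2
  deg Q      = 2
  deg Q′     = 2
  deg R      = 2
  deg R′     = 2
  deg (La k) = 4
  deg (Lb k) = 4
  deg (Ya k) = 3
  deg (Yb k) = 3
  deg (B k)  = 2
  deg (X k)  = 3

  length-neighbours : ∀ v → length (neighbours v) ≡ deg (layer v)
  length-neighbours (x , P)    = cong (2 ℕ.+_) (trans (List.length-++ (family x Ya) {colourNeighbours x})
    (cong₂ ℕ._+_ (List.length-tabulate (λ k → x , Ya k)) (List.length-tabulate (λ k → x ∙ colour k , B k))))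
  length-neighbours (x , N)    = cong (4 ℕ.+_) (trans (List.length-++ (family x Yb) {family x La ++ family x Lb})
    (cong₂ ℕ._+_ (List.length-tabulate (λ k → x , Yb k)) (trans (List.length-++ (family x La) {family x Lb})
      (cong₂ ℕ._+_ (List.length-tabulate (λ k → x , La k)) (List.length-tabulate (λ k → x , Lb k))))))
  length-neighbours (x , P′)   = refl
  length-neighbours (x , Q)    = refl
  length-neighbours (x , Q′)   = refl
  length-neighbours (x , R)    = refl
  length-neighbours (x , R′)   = refl
  length-neighbours (x , La k) = refl
  length-neighbours (x , Lb k) = refl
  length-neighbours (x , Ya k) = refl
  length-neighbours (x , Yb k) = refl
  length-neighbours (x , B k)  = refl
  length-neighbours (x , X k)  = refl

  degree-encode : ∀ v → degree graph (encode v) ≡ toℚ (deg (layer v))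
  degree-encode v = trans (mulAdj-encode (λ _ → 1ℚ) v) (trans (sumList-map-1 (neighbours v)) (cong toℚ (length-neighbours v)))

  deg-P≢4 : deg P ≢ 4
  deg-P≢4 eq = ℕ.1+n≢0 (trans (sym (ℕ.+-suc (m ℕ.+ n) K′))
    (ℕ.suc-injective (ℕ.suc-injective (ℕ.suc-injective (ℕ.suc-injective eq)))))

  deg-N≢deg-P : deg N ≢ deg P
  deg-N≢deg-P eq = ℕ.m≢1+n+m (K ℕ.+ K) {suc K} (sym (ℕ.suc-injective (ℕ.suc-injective eq)))

  -toℚ-suc<0 : ∀ a → - toℚ (suc a) < 0ℚ
  -toℚ-suc<0 a = ℚ.neg-antimono-< (0<toℚ-suc a)

  -1<0 : - 1ℚ < 0ℚ
  -1<0 = -toℚ-suc<0 0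

  1≢-1 : 1ℚ ≢ - 1ℚ
  1≢-1 = pos≢neg 0<1 -1<0

  odd-K≢1 : odd K ≢ 1ℚ
  odd-K≢1 eq with toℚ-injective {suc (K ℕ.+ K)} {1} eq
  ... | ()

  0<odd-K : 0ℚ < odd K
  0<odd-K = 0<toℚ-suc (K ℕ.+ K)

  -odd-K<0 : - odd K < 0ℚ
  -odd-K<0 = -toℚ-suc<0 (K ℕ.+ K)

  0<weight-La : ∀ k → 0ℚ < weight (La k)
  0<weight-La k = 0<toℚ-suc (toℕ k ℕ.+ toℕ k)

  weight-Lb<0 : ∀ k → weight (Lb k) < 0ℚ
  weight-Lb<0 k = -toℚ-suc<0 (suc (toℕ k ℕ.+ toℕ k))

  P-by-degree : ∀ ℓ → deg ℓ ≡ deg P → ℓ ≡ P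
  P-by-degree P      _  = refl
  P-by-degree N      eq = ⊥-elim (deg-N≢deg-P eq)
  P-by-degree (La k) eq = ⊥-elim (deg-P≢4 (sym eq))
  P-by-degree (Lb k) eq = ⊥-elim (deg-P≢4 (sym eq))
  P-by-degree P′     ()
  P-by-degree Q      ()
  P-by-degree Q′     ()
  P-by-degree R      ()
  P-by-degree R′     ()
  P-by-degree (Ya k) ()
  P-by-degree (Yb k) ()
  P-by-degree (B k)  ()
  P-by-degree (X k)  ()

  N-by-degree : ∀ ℓ → deg ℓ ≡ deg N → ℓ ≡ N
  N-by-degree N      _  = refl
  N-by-degree P      eq = ⊥-elim (deg-N≢deg-P (sym eq))
  N-by-degree P′     ()
  N-by-degree Q      ()
  N-by-degree Q′     ()
  N-by-degree R      ()
  N-by-degree R′     ()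
  N-by-degree (La k) ()
  N-by-degree (Lb k) ()
  N-by-degree (Ya k) ()
  N-by-degree (Yb k) ()
  N-by-degree (B k)  ()
  N-by-degree (X k)  ()

  La-by-weight : ∀ ℓ k → deg ℓ ≡ 4 → weight ℓ ≡ weight (La k) → ℓ ≡ La k
  La-by-weight P      k d _ = ⊥-elim (deg-P≢4 d)
  La-by-weight (La j) k _ w = cong La (Fin.toℕ-injective (odd-injective w))
  La-by-weight (Lb j) k _ w = ⊥-elim (pos≢neg (0<weight-La k) (weight-Lb<0 j) (sym w))
  La-by-weight N      k () _
  La-by-weight P′     k () _
  La-by-weight Q      k () _
  La-by-weight Q′     k () _
  La-by-weight R      k () _
  La-by-weight R′     k () _
  La-by-weight (Ya j) k () _
  La-by-weight (Yb j) k () _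
  La-by-weight (B j)  k () _
  La-by-weight (X j)  k () _

  Lb-by-weight : ∀ ℓ k → deg ℓ ≡ 4 → weight ℓ ≡ weight (Lb k) → ℓ ≡ Lb k
  Lb-by-weight P      k d _ = ⊥-elim (deg-P≢4 d)
  Lb-by-weight (Lb j) k _ w = cong Lb (Fin.toℕ-injective (+-self-injective (ℕ.suc-injective (ℕ.suc-injective (toℚ-injective (ℚ.neg-injective w))))))
  Lb-by-weight (La j) k _ w = ⊥-elim (pos≢neg (0<weight-La j) (weight-Lb<0 k) w)
  Lb-by-weight N      k () _
  Lb-by-weight P′     k () _
  Lb-by-weight Q      k () _
  Lb-by-weight Q′     k () _
  Lb-by-weight R      k () _
  Lb-by-weight R′     k () _
  Lb-by-weight (Ya j) k () _
  Lb-by-weight (Yb j) k () _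
  Lb-by-weight (B j)  k () _
  Lb-by-weight (X j)  k () _

  Q-by-weight : ∀ ℓ → deg ℓ ≡ 2 → weight ℓ ≡ weight Q → ℓ ≡ Q
  Q-by-weight Q      _ _ = refl
  Q-by-weight P′     _ w = ⊥-elim (pos≢neg 0<1 -odd-K<0 w)
  Q-by-weight Q′     _ w = ⊥-elim (odd-K≢1 (sym (ℚ.neg-injective w)))
  Q-by-weight R      _ w = ⊥-elim (pos≢neg 0<1 -odd-K<0 w)
  Q-by-weight R′     _ w = ⊥-elim (pos≢neg 0<odd-K -odd-K<0 w)
  Q-by-weight (B k)  _ w = ⊥-elim (pos≢neg 0<1 -odd-K<0 w)
  Q-by-weight P      () _
  Q-by-weight N      () _
  Q-by-weight (La k) () _
  Q-by-weight (Lb k) () _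
  Q-by-weight (Ya k) () _
  Q-by-weight (Yb k) () _
  Q-by-weight (X k)  () _

  Q′-by-weight : ∀ ℓ → deg ℓ ≡ 2 → weight ℓ ≡ - 1ℚ → ℓ ≡ Q′
  Q′-by-weight Q′     _ _ = refl
  Q′-by-weight P′     _ w = ⊥-elim (1≢-1 w)
  Q′-by-weight Q      _ w = ⊥-elim (odd-K≢1 (ℚ.neg-injective w))
  Q′-by-weight R      _ w = ⊥-elim (1≢-1 w)
  Q′-by-weight R′     _ w = ⊥-elim (pos≢neg 0<odd-K -1<0 w)
  Q′-by-weight (B k)  _ w = ⊥-elim (1≢-1 w)
  Q′-by-weight P      () _
  Q′-by-weight N      () _
  Q′-by-weight (La k) () _
  Q′-by-weight (Lb k) () _
  Q′-by-weight (Ya k) () _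
  Q′-by-weight (Yb k) () _
  Q′-by-weight (X k)  () _

  R′-by-weight : ∀ ℓ → deg ℓ ≡ 2 → weight ℓ ≡ odd K → ℓ ≡ R′
  R′-by-weight R′     _ _ = refl
  R′-by-weight P′     _ w = ⊥-elim (odd-K≢1 (sym w))
  R′-by-weight Q      _ w = ⊥-elim (pos≢neg 0<odd-K -odd-K<0 (sym w))
  R′-by-weight Q′     _ w = ⊥-elim (pos≢neg 0<odd-K -1<0 (sym w))
  R′-by-weight R      _ w = ⊥-elim (odd-K≢1 (sym w))
  R′-by-weight (B k)  _ w = ⊥-elim (odd-K≢1 (sym w))
  R′-by-weight P      () _
  R′-by-weight N      () _
  R′-by-weight (La k) () _
  R′-by-weight (Lb k) () _
  R′-by-weight (Ya k) () _
  R′-by-weight (Yb k) () _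
  R′-by-weight (X k)  () _

  -- Degree and weight pin down every layer except within {P′, R, B k}, {X k} and {Ya k, Yb k};
  -- there a neighbour in an already identified layer decides.
  degree-2-weight-1 : ∀ ℓ → deg ℓ ≡ 2 → weight ℓ ≡ 1ℚ → ℓ ≡ P′ ⊎ ℓ ≡ R ⊎ ∃ λ k → ℓ ≡ B k
  degree-2-weight-1 P′     _ _ = inj₁ refl
  degree-2-weight-1 R      _ _ = inj₂ (inj₁ refl)
  degree-2-weight-1 (B k)  _ _ = inj₂ (inj₂ (k , refl))
  degree-2-weight-1 Q      _ w = ⊥-elim (pos≢neg 0<1 -odd-K<0 (sym w))
  degree-2-weight-1 Q′     _ w = ⊥-elim (1≢-1 (sym w))
  degree-2-weight-1 R′     _ w = ⊥-elim (odd-K≢1 w)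
  degree-2-weight-1 P      () _
  degree-2-weight-1 N      () _
  degree-2-weight-1 (La k) () _
  degree-2-weight-1 (Lb k) () _
  degree-2-weight-1 (Ya k) () _
  degree-2-weight-1 (Yb k) () _
  degree-2-weight-1 (X k)  () _

  degree-3-weight-1 : ∀ ℓ → deg ℓ ≡ 3 → weight ℓ ≡ 1ℚ → (∃ λ k → ℓ ≡ Ya k) ⊎ (∃ λ k → ℓ ≡ Yb k)
  degree-3-weight-1 (Ya k) _ _ = inj₁ (k , refl)
  degree-3-weight-1 (Yb k) _ _ = inj₂ (k , refl)
  degree-3-weight-1 (X k)  _ w = ⊥-elim (1≢-1 (sym w))
  degree-3-weight-1 P      () _
  degree-3-weight-1 N      () _
  degree-3-weight-1 P′     () _
  degree-3-weight-1 Q      () _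
  degree-3-weight-1 Q′     () _
  degree-3-weight-1 R      () _
  degree-3-weight-1 R′     () _
  degree-3-weight-1 (La k) () _
  degree-3-weight-1 (Lb k) () _
  degree-3-weight-1 (B k)  () _

  degree-3-weight-−1 : ∀ ℓ → deg ℓ ≡ 3 → weight ℓ ≡ - 1ℚ → ∃ λ k → ℓ ≡ X k
  degree-3-weight-−1 (X k)  _ _ = k , refl
  degree-3-weight-−1 (Ya k) _ w = ⊥-elim (1≢-1 w)
  degree-3-weight-−1 (Yb k) _ w = ⊥-elim (1≢-1 w)
  degree-3-weight-−1 P      () _
  degree-3-weight-−1 N      () _
  degree-3-weight-−1 P′     () _
  degree-3-weight-−1 Q      () _
  degree-3-weight-−1 Q′     () _
  degree-3-weight-−1 R      () _
  degree-3-weight-−1 R′     () _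
  degree-3-weight-−1 (La k) () _
  degree-3-weight-−1 (Lb k) () _
  degree-3-weight-−1 (B k)  () _

  Adjacent-Link⇒same-copy : ∀ {y z ℓ ℓ′} → Adjacent (y , ℓ) (z , ℓ′) → Link ℓ ℓ′ → z ≡ y
  Adjacent-Link⇒same-copy (inj₁ (link _))   _  = refl
  Adjacent-Link⇒same-copy (inj₂ (link _))   _  = refl
  Adjacent-Link⇒same-copy (inj₁ (bridge _)) ()
  Adjacent-Link⇒same-copy (inj₂ (bridge _)) ()

  Adjacent-P-B⇒bridge : ∀ {y z k} → Adjacent (y , P) (z , B k) → z ≡ y ∙ colour k
  Adjacent-P-B⇒bridge (inj₁ (bridge _)) = refl
  Adjacent-P-B⇒bridge (inj₁ (link ()))
  Adjacent-P-B⇒bridge (inj₂ (link ()))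

  X-by-neighbour : ∀ {y z ℓ k} → deg ℓ ≡ 3 → weight ℓ ≡ - 1ℚ → Adjacent (y , ℓ) (z , La k) → ℓ ≡ X k
  X-by-neighbour {ℓ = ℓ} d w a with degree-3-weight-−1 ℓ d w
  ... | _ , refl with a
  ...   | inj₁ (link ())
  ...   | inj₂ (link (La-X _)) = refl

  P′-by-neighbour : ∀ {y z ℓ} → deg ℓ ≡ 2 → weight ℓ ≡ 1ℚ → Adjacent (y , ℓ) (z , Q′) → ℓ ≡ P′
  P′-by-neighbour {ℓ = ℓ} d w a with degree-2-weight-1 ℓ d w
  ... | inj₁ refl = refl
  ... | inj₂ (inj₁ refl) with a
  ...   | inj₁ (link ())
  ...   | inj₂ (link ())
  P′-by-neighbour d w a | inj₂ (inj₂ (_ , refl)) with a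
  ...   | inj₁ (link ())
  ...   | inj₂ (link ())

  R-by-neighbour : ∀ {y z ℓ} → deg ℓ ≡ 2 → weight ℓ ≡ 1ℚ → Adjacent (y , ℓ) (z , La zero) → ℓ ≡ R
  R-by-neighbour {ℓ = ℓ} d w a with degree-2-weight-1 ℓ d w
  ... | inj₂ (inj₁ refl) = refl
  ... | inj₁ refl with a
  ...   | inj₁ (link ())
  ...   | inj₂ (link ())
  R-by-neighbour d w a | inj₂ (inj₂ (_ , refl)) with a
  ...   | inj₁ (link ())
  ...   | inj₂ (link ())

  B-by-neighbour : ∀ {y z ℓ k} → deg ℓ ≡ 2 → weight ℓ ≡ 1ℚ → Adjacent (y , ℓ) (z , X k) → ℓ ≡ B k
  B-by-neighbour {ℓ = ℓ} d w a with degree-2-weight-1 ℓ d w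
  ... | inj₁ refl with a
  ...   | inj₁ (link ())
  ...   | inj₂ (link ())
  B-by-neighbour d w a | inj₂ (inj₁ refl) with a
  ...   | inj₁ (link ())
  ...   | inj₂ (link ())
  B-by-neighbour d w a | inj₂ (inj₂ (_ , refl)) with a
  ...   | inj₁ (link ())
  ...   | inj₂ (link (X-B _)) = refl

  Ya-by-neighbours : ∀ {y z z′ ℓ k} → deg ℓ ≡ 3 → weight ℓ ≡ 1ℚ →
    Adjacent (y , ℓ) (z , La k) → Adjacent (y , ℓ) (z′ , P) → ℓ ≡ Ya k
  Ya-by-neighbours {ℓ = ℓ} d w a a′ with degree-3-weight-1 ℓ d w
  ... | inj₁ (_ , refl) with a
  ...   | inj₁ (link ())
  ...   | inj₂ (link (La-Ya _)) = refl
  Ya-by-neighbours d w a a′ | inj₂ (_ , refl) with a′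
  ...   | inj₁ (link ())
  ...   | inj₂ (link ())

  Yb-by-neighbours : ∀ {y z z′ ℓ k} → deg ℓ ≡ 3 → weight ℓ ≡ 1ℚ →
    Adjacent (y , ℓ) (z , Lb k) → Adjacent (y , ℓ) (z′ , N) → ℓ ≡ Yb k
  Yb-by-neighbours {ℓ = ℓ} d w a a′ with degree-3-weight-1 ℓ d w
  ... | inj₂ (_ , refl) with a
  ...   | inj₁ (link ())
  ...   | inj₂ (link (Lb-Yb _)) = refl
  Yb-by-neighbours d w a a′ | inj₁ (_ , refl) with a′
  ...   | inj₁ (link ())
  ...   | inj₂ (link ())

  module Rigidity (σ : Automorphism graph) where
    open GraphIso σ

    σᵛ : Vertex → Vertex
    σᵛ = decode ∘ to ∘ encode

    σ-Adjacent : ∀ {v w} → Adjacent v w → Adjacent (σᵛ v) (σᵛ w)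
    σ-Adjacent {v} {w} v∼w = adj⇒Adjacent (trans (preserves (encode v) (encode w)) (Adjacent⇒adj v∼w))

    σ-Adjacent-into : ∀ {v w ℓ} → Adjacent v w → layer (σᵛ w) ≡ ℓ → Adjacent (σᵛ v) (copy (σᵛ w) , ℓ)
    σ-Adjacent-into v∼w refl = σ-Adjacent v∼w

    σ-deg : ∀ v → deg (layer (σᵛ v)) ≡ deg (layer v)
    σ-deg v = toℚ-injective (begin
      toℚ (deg (layer (σᵛ v)))      ≡⟨ sym (degree-encode (σᵛ v)) ⟩
      degree graph (encode (σᵛ v))  ≡⟨ cong (degree graph) (encode-decode (to (encode v))) ⟩
      degree graph (to (encode v))  ≡⟨ degree-automorphism σ (encode v) ⟩
      degree graph (encode v)       ≡⟨ degree-encode v ⟩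
      toℚ (deg (layer v))           ∎)

    module PulledBack = Spanning (kernelVector ∘ to) (InKernel-automorphism σ kernelVector-kernel)

    σ-weight-scaled : ∀ v → weight (layer (σᵛ v)) ≡ PulledBack.g ε * weight (layer v)
    σ-weight-scaled v = trans (PulledBack.y≡c*kernelVector (encode v)) (cong (λ u → PulledBack.g ε * weight (layer u)) (decode-encode v))

    σ-P : ∀ x → layer (σᵛ (x , P)) ≡ P
    σ-P x = P-by-degree _ (σ-deg (x , P))

    scale≡1 : PulledBack.g ε ≡ 1ℚ
    scale≡1 = sym (trans (sym (cong weight (σ-P ε))) (trans (σ-weight-scaled (ε , P)) (ℚ.*-identityʳ (PulledBack.g ε))))

    σ-weight : ∀ v → weight (layer (σᵛ v)) ≡ weight (layer v)
    σ-weight v = trans (σ-weight-scaled v) (trans (cong (_* weight (layer v)) scale≡1) (ℚ.*-identityˡ (weight (layer v))))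

    σ-N : ∀ x → layer (σᵛ (x , N)) ≡ N
    σ-N x = N-by-degree _ (σ-deg (x , N))

    σ-La : ∀ x k → layer (σᵛ (x , La k)) ≡ La k
    σ-La x k = La-by-weight _ k (σ-deg (x , La k)) (σ-weight (x , La k))

    σ-Lb : ∀ x k → layer (σᵛ (x , Lb k)) ≡ Lb k
    σ-Lb x k = Lb-by-weight _ k (σ-deg (x , Lb k)) (σ-weight (x , Lb k))

    σ-Q′ : ∀ x → layer (σᵛ (x , Q′)) ≡ Q′
    σ-Q′ x = Q′-by-weight _ (σ-deg (x , Q′)) (σ-weight (x , Q′))

    σ-X : ∀ x k → layer (σᵛ (x , X k)) ≡ X k
    σ-X x k = X-by-neighbour (σ-deg (x , X k)) (σ-weight (x , X k)) (σ-Adjacent-into (inj₂ (link (La-X k))) (σ-La x k))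

    σ-P′ : ∀ x → layer (σᵛ (x , P′)) ≡ P′
    σ-P′ x = P′-by-neighbour (σ-deg (x , P′)) (σ-weight (x , P′)) (σ-Adjacent-into (inj₁ (link P′-Q′)) (σ-Q′ x))

    σ-R : ∀ x → layer (σᵛ (x , R)) ≡ R
    σ-R x = R-by-neighbour (σ-deg (x , R)) (σ-weight (x , R)) (σ-Adjacent-into (inj₁ (link R-La)) (σ-La x zero))

    σ-B : ∀ x k → layer (σᵛ (x , B k)) ≡ B k
    σ-B x k = B-by-neighbour (σ-deg (x , B k)) (σ-weight (x , B k)) (σ-Adjacent-into (inj₂ (link (X-B k))) (σ-X x k))

    σ-Ya : ∀ x k → layer (σᵛ (x , Ya k)) ≡ Ya k
    σ-Ya x k = Ya-by-neighbours (σ-deg (x , Ya k)) (σ-weight (x , Ya k))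
      (σ-Adjacent-into (inj₂ (link (La-Ya k))) (σ-La x k)) (σ-Adjacent-into (inj₂ (link (P-Ya k))) (σ-P x))

    σ-Yb : ∀ x k → layer (σᵛ (x , Yb k)) ≡ Yb k
    σ-Yb x k = Yb-by-neighbours (σ-deg (x , Yb k)) (σ-weight (x , Yb k))
      (σ-Adjacent-into (inj₂ (link (Lb-Yb k))) (σ-Lb x k)) (σ-Adjacent-into (inj₂ (link (N-Yb k))) (σ-N x))

    σ-layer : ∀ v → layer (σᵛ v) ≡ layer v
    σ-layer (x , P)    = σ-P x
    σ-layer (x , N)    = σ-N x
    σ-layer (x , P′)   = σ-P′ x
    σ-layer (x , Q)    = Q-by-weight _ (σ-deg (x , Q)) (σ-weight (x , Q))
    σ-layer (x , Q′)   = σ-Q′ x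
    σ-layer (x , R)    = σ-R x
    σ-layer (x , R′)   = R′-by-weight _ (σ-deg (x , R′)) (σ-weight (x , R′))
    σ-layer (x , La k) = σ-La x k
    σ-layer (x , Lb k) = σ-Lb x k
    σ-layer (x , Ya k) = σ-Ya x k
    σ-layer (x , Yb k) = σ-Yb x k
    σ-layer (x , B k)  = σ-B x k
    σ-layer (x , X k)  = σ-X x k

    σ-Adjacent-layers : ∀ {v w} → Adjacent v w → Adjacent (copy (σᵛ v) , layer v) (copy (σᵛ w) , layer w)
    σ-Adjacent-layers {v} {w} v∼w = subst₂ (λ ℓ ℓ′ → Adjacent (copy (σᵛ v) , ℓ) (copy (σᵛ w) , ℓ′)) (σ-layer v) (σ-layer w) (σ-Adjacent v∼w)

    σ-copy-Link : ∀ {x ℓ ℓ′} → Link ℓ ℓ′ → copy (σᵛ (x , ℓ′)) ≡ copy (σᵛ (x , ℓ))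
    σ-copy-Link l = Adjacent-Link⇒same-copy (σ-Adjacent-layers (inj₁ (link l))) l

    π : Fin n → Fin n
    π x = copy (σᵛ (x , P))

    σ-copy-N : ∀ x → copy (σᵛ (x , N)) ≡ π x
    σ-copy-N x = trans (sym (σ-copy-Link N-Q)) (σ-copy-Link P-Q)

    σ-copy-La : ∀ x k → copy (σᵛ (x , La k)) ≡ π x
    σ-copy-La x k = trans (σ-copy-Link (N-La k)) (σ-copy-N x)

    σ-copy-X : ∀ x k → copy (σᵛ (x , X k)) ≡ π x
    σ-copy-X x k = trans (σ-copy-Link (La-X k)) (σ-copy-La x k)

    σ-copy : ∀ v → copy (σᵛ v) ≡ π (copy v)
    σ-copy (x , P)    = refl
    σ-copy (x , N)    = σ-copy-N x
    σ-copy (x , P′)   = σ-copy-Link P-P′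
    σ-copy (x , Q)    = σ-copy-Link P-Q
    σ-copy (x , Q′)   = trans (σ-copy-Link N-Q′) (σ-copy-N x)
    σ-copy (x , R)    = trans (σ-copy-Link N-R) (σ-copy-N x)
    σ-copy (x , R′)   = trans (σ-copy-Link N-R′) (σ-copy-N x)
    σ-copy (x , La k) = σ-copy-La x k
    σ-copy (x , Lb k) = trans (σ-copy-Link (N-Lb k)) (σ-copy-N x)
    σ-copy (x , Ya k) = σ-copy-Link (P-Ya k)
    σ-copy (x , Yb k) = trans (σ-copy-Link (N-Yb k)) (σ-copy-N x)
    σ-copy (x , B k)  = trans (σ-copy-Link (X-B k)) (σ-copy-X x k)
    σ-copy (x , X k)  = σ-copy-X x k

    π-colour : ∀ x k → π (x ∙ colour k) ≡ π x ∙ colour k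
    π-colour x k = trans (sym (σ-copy (x ∙ colour k , B k))) (Adjacent-P-B⇒bridge (σ-Adjacent-layers (inj₁ (bridge k))))

    π-∙ : ∀ x g → π (x ∙ g) ≡ π x ∙ g
    π-∙ x g = subst (λ c → π (x ∙ c) ≡ π x ∙ c) (colour-↑ʳ g) (π-colour x (suc (suc m) ↑ʳ g))

    σᵛ≡translate : ∀ v → σᵛ v ≡ translate (π ε) v
    σᵛ≡translate v = cong₂ _,_ (trans (σ-copy v) (trans (cong π (sym (identityˡ (copy v)))) (π-∙ ε (copy v)))) (σ-layer v)

    σ≡translation : ∀ i → to i ≡ translation (π ε) i
    σ≡translation i = begin
      to i                          ≡⟨ cong to (sym (encode-decode i)) ⟩
      to (encode (decode i))        ≡⟨ sym (encode-decode (to (encode (decode i)))) ⟩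
      encode (σᵛ (decode i))        ≡⟨ cong encode (σᵛ≡translate (decode i)) ⟩
      translation (π ε) i           ∎

module FromFiniteGroup {c ℓ} (𝔊 : Group c ℓ) (finite : FiniteGroup 𝔊) where
  private
    module 𝔊 = Group 𝔊

  n : ℕ
  n = proj₁ finite

  toFin : 𝔊.Carrier → Fin n
  toFin = proj₁ (proj₂ finite)

  fromFin : Fin n → 𝔊.Carrier
  fromFin = proj₁ (proj₂ (proj₂ finite))

  toFin-cong : ∀ {x y} → x 𝔊.≈ y → toFin x ≡ toFin y
  toFin-cong = proj₁ (proj₂ (proj₂ (proj₂ finite)))

  fromFin-toFin : ∀ x → fromFin (toFin x) 𝔊.≈ x
  fromFin-toFin = proj₁ (proj₂ (proj₂ (proj₂ (proj₂ finite))))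

  toFin-fromFin : ∀ i → toFin (fromFin i) ≡ i
  toFin-fromFin = proj₂ (proj₂ (proj₂ (proj₂ (proj₂ finite))))

  toFin-injective : ∀ {x y} → toFin x ≡ toFin y → x 𝔊.≈ y
  toFin-injective {x} {y} eq = 𝔊.trans (𝔊.sym (fromFin-toFin x)) (𝔊.trans (𝔊.reflexive (cong fromFin eq)) (fromFin-toFin y))

  infixl 7 _∙_
  _∙_ : Fin n → Fin n → Fin n
  a ∙ b = toFin (fromFin a 𝔊.∙ fromFin b)

  toFin-∙ : ∀ x y → toFin (x 𝔊.∙ y) ≡ toFin x ∙ toFin y
  toFin-∙ x y = toFin-cong (𝔊.∙-cong (𝔊.sym (fromFin-toFin x)) (𝔊.sym (fromFin-toFin y)))

  finGroup : FinGroup n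
  finGroup = record
    { _∙_     = _∙_
    ; ε       = toFin 𝔊.ε
    ; _⁻¹     = λ a → toFin (fromFin a 𝔊.⁻¹)
    ; isGroup = record
      { isMonoid = record
        { isSemigroup = record
          { isMagma = record { isEquivalence = isEquivalence ; ∙-cong = cong₂ _∙_ }
          ; assoc   = λ a b c → toFin-cong (𝔊.trans (𝔊.∙-cong (fromFin-toFin _) 𝔊.refl)
                        (𝔊.trans (𝔊.assoc (fromFin a) (fromFin b) (fromFin c)) (𝔊.∙-cong 𝔊.refl (𝔊.sym (fromFin-toFin _)))))
          }
        ; identity = (λ a → trans (toFin-cong (𝔊.trans (𝔊.∙-cong (fromFin-toFin _) 𝔊.refl) (𝔊.identityˡ (fromFin a)))) (toFin-fromFin a))
                   , (λ a → trans (toFin-cong (𝔊.trans (𝔊.∙-cong 𝔊.refl (fromFin-toFin _)) (𝔊.identityʳ (fromFin a)))) (toFin-fromFin a))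
        }
      ; inverse = (λ a → toFin-cong (𝔊.trans (𝔊.∙-cong (fromFin-toFin _) 𝔊.refl) (𝔊.inverseˡ (fromFin a))))
                , (λ a → toFin-cong (𝔊.trans (𝔊.∙-cong 𝔊.refl (fromFin-toFin _)) (𝔊.inverseʳ (fromFin a))))
      ; ⁻¹-cong = cong (λ a → toFin (fromFin a 𝔊.⁻¹))
      }
    }

  nutGraph : ℕ → Graph
  nutGraph = Construction.graph finGroup

  Aut≅𝔊 : ∀ m → AutIso 𝔊 (nutGraph m)
  Aut≅𝔊 m = record
    { φ            = translation-automorphism ∘ toFin
    ; φ-cong       = λ x≈y i → cong (λ a → translation a i) (toFin-cong x≈y)
    ; φ-hom        = λ x y i → trans (cong (λ a → translation a i) (toFin-∙ x y)) (translation-∙ (toFin x) (toFin y) i)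
    ; φ-injective  = toFin-injective ∘ translation-injective
    ; φ-surjective = λ σ → fromFin (Rigidity.π σ ε) , λ i →
        trans (cong (λ a → translation a i) (toFin-fromFin _)) (sym (Rigidity.σ≡translation σ i))
    }
    where
    open Construction finGroup m
    open FinGroup finGroup using (ε)

  order-injective : ∀ {k l} → order (nutGraph k) ≡ order (nutGraph l) → k ≡ l
  order-injective {k} {l} eq = ℕ.+-cancelʳ-≡ n k l (ℕ.suc-injective (ℕ.suc-injective
    (ℕ.*-cancelˡ-≡ _ _ 6 (ℕ.+-cancelˡ-≡ 7 _ _ (ℕ.*-cancelˡ-≡ _ _ n {{nonZero (toFin 𝔊.ε)}} eq)))))
    where
    nonZero : ∀ {a} → Fin a → ℕ.NonZero a
    nonZero {suc a} _ = _

theorem1 : ∀ {c ℓ} (𝔊 : Group c ℓ) → FiniteGroup 𝔊 →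
    Σ (ℕ → Graph) λ G →
      (∀ k → IsNut (G k) × AutIso 𝔊 (G k)) ×
      (∀ k l → k ≢ l → ¬ GraphIso (G k) (G l))
theorem1 𝔊 finite =
  nutGraph , (λ m → Construction.graph-IsNut finGroup m , Aut≅𝔊 m) , λ k l k≢l → k≢l ∘ order-injective ∘ GraphIso⇒order≡
  where open FromFiniteGroup 𝔊 finite
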